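{- Let $\alpha$ be a composition of $m$ with $s$ parts, let $n\ge s$, let $\lambda\vdash m$ and let $S$ be any standard tableau of shape $\lambda$ with $DesComp(S)=\alpha$. Then the subgraph $B(T_\alpha)_n$ of $B(\lambda)_n$ induced on $V^n_S=\{T\in SSYT(\lambda)_n: std(T)=S\}$ is isomorphic, as a directed graph (forgetting edge labels), to the crystal graph $B((m))_{n-s+1}$ of one-row tableaux with $m$ cells and entries at most $n-s+1$. In particular, the directed graph structure of $B(T_\alpha)_n$ does not depend on the partition $\lambda$ (nor on $S$) for which $\alpha$ is a descent composition.
   Context: Tableaux of shape $\lambda$: fillings of the Young diagram (English notation) by positive integers weakly increasing along rows, strictly increasing down columns; $SSYT(\lambda)_n$: those with entries $\le n$. Row reading word $rw(T)$: rows left to right, from bottom row to top row. Crystal operators on words over $\{1,\dots,n\}$, $1\le i\le n-1$: place ")" under each $i$ and "(" under each $i+1$, repeatedly delete a "(" immediately followed (among remaining symbols) by ")", leaving $)^{\varphi}(^{\varepsilon}$; $f_i$ changes the $i$ of the rightmost unmatched ")" into $i+1$ (undefined if $\varphi=0$). On tableaux: apply $f_i$ to $rw(T)$ and change the corresponding entry. $B(\lambda)_n$: directed graph on $SSYT(\lambda)_n$ with edge $T\to T'$ labelled $i$ when $f_i(T)=T'$. In particular $B((m))_k$ is this graph for the one-row shape $(m)$ with entries $\le k$. Standardization $std(T)$ of $T$ of weight $\gamma$: replace entries $1$ left to right by $1,\dots,\gamma_1$, entries $2$ left to right by $\gamma_1+1,\dots,\gamma_1+\gamma_2$, etc. Descent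 of a standard $S$ with $m$ cells: $i$ with $i+1$ in a strictly lower row than $i$; with descents $d_1<\dots<d_k$, $DesComp(S)=(d_1,d_2-d_1,\dots,m-d_k)$. $T_\alpha$: obtained from $S$ (with $DesComp(S)=\alpha$) by replacing entries $\alpha_1+\dots+\alpha_{r-1}+1,\dots,\alpha_1+\dots+\alpha_r$ by $r$; $B(T_\alpha)_n$ denotes the edge-labelled subgraph of $B(\lambda)_n$ induced on $V^n_S$. -}

module Defs where

open import Data.Nat using (ℕ; zero; suc; _+_; _∸_; _≤_; _<_; _<ᵇ_; _≡ᵇ_)
open import Data.Bool using (Bool; true; false; _∧_; if_then_else_)
open import Data.List using (List; []; _∷_; _++_; map; length; concat; reverse; take; drop; filterᵇ; upTo)
open import Data.Nat.ListAction using (sum)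
open import Data.List.Relation.Unary.All using (All)
open import Data.Maybe using (Maybe; just; nothing)
open import Data.Product using (Σ; ∃; _×_; _,_)
open import Function.Bundles using (_⇔_)
open import Relation.Binary.PropositionalEquality using (_≡_)

-- Tableaux: a filling is a list of rows (top row first, English notation),
-- each row a list of entries read left to right.  Row r, column c are
-- 0-indexed.

Filling : Set
Filling = List (List ℕ)

shape : Filling → List ℕ
shape = map length

lookupL : List ℕ → ℕ → Maybe ℕ
lookupL []       _       = nothing
lookupL (x ∷ xs) zero    = just x
lookupL (x ∷ xs) (suc c) = lookupL xs c

entry : Filling → ℕ → ℕ → Maybe ℕ
entry []         _       c = nothing
entry (row ∷ T)  zero    c = lookupL row c
entry (row ∷ T)  (suc r) c = entry T r c

Decreasing : List ℕ → Set
Decreasing []           = Data.Unit.⊤ where import Data.Unit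
Decreasing (a ∷ [])     = Data.Unit.⊤ where import Data.Unit
Decreasing (a ∷ b ∷ l)  = (b ≤ a) × Decreasing (b ∷ l)

IsPartition : ℕ → List ℕ → Set
IsPartition m λ′ = All (λ a → 1 ≤ a) λ′ × Decreasing λ′ × sum λ′ ≡ m

IsComposition : ℕ → ℕ → List ℕ → Set
IsComposition m s α = All (λ a → 1 ≤ a) α × sum α ≡ m × length α ≡ s

SSYT : List ℕ → ℕ → Filling → Set
SSYT λ′ n T =
  shape T ≡ λ′
  × (∀ r c v → entry T r c ≡ just v → 1 ≤ v × v ≤ n)
  × (∀ r c v w → entry T r c ≡ just v → entry T r (suc c) ≡ just w → v ≤ w)
  × (∀ r c v w → entry T r c ≡ just v → entry T (suc r) c ≡ just w → v < w)

-- Standard tableau of shape λ ⊢ m: semistandard with entries in {1..m},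
-- all entries distinct (hence exactly 1..m, each once, since there are m cells).
Standard : List ℕ → ℕ → Filling → Set
Standard λ′ m S =
  SSYT λ′ m S
  × (∀ r c r′ c′ v → entry S r c ≡ just v → entry S r′ c′ ≡ just v → r ≡ r′ × c ≡ c′)

Cell : Set
Cell = ℕ × ℕ × ℕ

rowCells : ℕ → ℕ → List ℕ → List Cell
rowCells r c []       = []
rowCells r c (x ∷ xs) = (r , c , x) ∷ rowCells r (suc c) xs

allCells : ℕ → Filling → List Cell
allCells r []          = []
allCells r (row ∷ T)   = rowCells r 0 row ++ allCells (suc r) T

cells : Filling → List Cell
cells = allCells 0

cellEntry : Cell → ℕ
cellEntry (_ , _ , x) = x

cellCol : Cell → ℕ
cellCol (_ , c , _) = c

cellRow : Cell → ℕ
cellRow (r , _ , _) = r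

-- Standardization: the cell in column c with entry v gets
-- 1 + #{cells with entry < v} + #{cells with entry v in a column < c}
-- (i.e. entries v are relabelled left to right after all smaller entries).

stdRow : List Cell → ℕ → List ℕ → List ℕ
stdRow cs c []       = []
stdRow cs c (v ∷ xs) =
  suc (length (filterᵇ (λ x → cellEntry x <ᵇ v) cs)
       + length (filterᵇ (λ x → (cellEntry x ≡ᵇ v) ∧ (cellCol x <ᵇ c)) cs))
  ∷ stdRow cs (suc c) xs

std : Filling → Filling
std T = map (stdRow (cells T) 0) T

rowOfIn : List Cell → ℕ → ℕ
rowOfIn []       k = 0
rowOfIn (x ∷ cs) k = if cellEntry x ≡ᵇ k then cellRow x else rowOfIn cs k

rowOf : Filling → ℕ → ℕ
rowOf S k = rowOfIn (cells S) k

numCells : Filling → ℕ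
numCells S = length (concat S)

descents : Filling → List ℕ
descents S = filterᵇ (λ i → rowOf S i <ᵇ rowOf S (suc i)) (map suc (upTo (numCells S ∸ 1)))

diffs : ℕ → ℕ → List ℕ → List ℕ
diffs m prev []       = (m ∸ prev) ∷ []
diffs m prev (d ∷ ds) = (d ∸ prev) ∷ diffs m d ds

DesComp : Filling → List ℕ
DesComp S = diffs (numCells S) 0 (descents S)

-- scan left to right: `opens` = number of currently unmatched "(" (letters i+1);
-- a letter i (")") is matched with an unmatched "(" to its left if there is one,
-- otherwise it is an unmatched ")"; `last` = position of the rightmost
-- unmatched ")" found so far.
rightmostUnmatched : ℕ → List ℕ → ℕ → ℕ → Maybe ℕ → Maybe ℕ
rightmostUnmatched i []       opens pos last = last
rightmostUnmatched i (x ∷ xs) opens pos last =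
  if x ≡ᵇ i
  then (if opens ≡ᵇ 0
        then rightmostUnmatched i xs 0 (suc pos) (just pos)
        else rightmostUnmatched i xs (opens ∸ 1) (suc pos) last)
  else (if x ≡ᵇ suc i
        then rightmostUnmatched i xs (suc opens) (suc pos) last
        else rightmostUnmatched i xs opens (suc pos) last)

setAt : ℕ → ℕ → List ℕ → List ℕ
setAt p y []             = []
setAt zero    y (x ∷ xs) = y ∷ xs
setAt (suc p) y (x ∷ xs) = x ∷ setAt p y xs

fWord : ℕ → List ℕ → Maybe (List ℕ)
fWord i w with rightmostUnmatched i w 0 0 nothing
... | nothing = nothing
... | just p  = just (setAt p (suc i) w)

rw : Filling → List ℕ
rw T = concat (reverse T)

splitBy : List ℕ → List ℕ → Filling
splitBy []       w = []
splitBy (k ∷ ks) w = take k w ∷ splitBy ks (drop k w)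

fTab : ℕ → Filling → Maybe Filling
fTab i T with fWord i (rw T)
... | nothing = nothing
... | just w  = just (reverse (splitBy (reverse (shape T)) w))

Edge : ℕ → Filling → Filling → Set
Edge n T T′ = ∃ λ i → 1 ≤ i × i < n × fTab i T ≡ just T′

VS : List ℕ → ℕ → Filling → Filling → Set
VS λ′ n S T = SSYT λ′ n T × std T ≡ S

DiGraphIso : {A B : Set} → (A → Set) → (A → A → Set) → (B → Set) → (B → B → Set) → Set
DiGraphIso {A} {B} V E W F =
  Σ (A → B) λ φ →
      (∀ x → V x → W (φ x))
    × (∀ x y → V x → V y → φ x ≡ φ y → x ≡ y)
    × (∀ y → W y → ∃ λ x → V x × φ x ≡ y)
    × (∀ x y → V x → V y → (E x y ⇔ F (φ x) (φ y)))

-- Read a filling T of shape λ at the labels of S: T(j) is its entry in the cell of S holding j.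
-- As standardization numbers equal entries from left to right, T ∈ SSYT(λ)_n has std T = S
-- exactly when T(1), …, T(m) lie in [1, n] and increase weakly, strictly across every descent
-- of S. Subtracting from T(j) the number of descents below j (S has s − 1 of them) turns these
-- sequences bijectively into the weakly increasing sequences in [1, n − s + 1], i.e. the
-- one-row tableaux of B((m))_{n−s+1}. An edge f_i changes one entry i into i+1, so between such
-- fillings it raises one label; conversely, raising a label j within V^n_S is f_{T(j)}, since
-- every other entry T(j) lies south-west of that cell and every entry T(j)+1 north-east of it,
-- making its letter the rightmost unmatched one. Flattening commutes with raising a label.

module Submission where

open import Defs

open import Data.Nat using (ℕ; zero; suc; _+_; _∸_; _≤_; _<_; _<ᵇ_; _≡ᵇ_; z≤n; s≤s; _≟_; _≤?_)
open import Data.Nat.Properties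
open import Data.Nat.ListAction using (sum)
open import Algebra.Properties.CommutativeSemigroup +-commutativeSemigroup using (interchange)
open import Data.Bool using (Bool; true; false; not; _∧_; T; if_then_else_)
open import Data.Bool.Properties using (T-≡)
open import Data.List using (List; []; _∷_; _++_; [_]; map; length; concat; reverse; take; drop; filterᵇ; upTo; applyUpTo)
open import Data.List.Properties
  using ( length-++; length-map; length-applyUpTo; filter-++; filter-all; ∷-injectiveˡ; ∷-injectiveʳ; ++-assoc
        ; ++-identityʳ; map-++; upTo-∷ʳ; concat-++; unfold-reverse; reverse-map; reverse-involutive )
open import Data.List.Relation.Unary.All using (All; []; _∷_)
import Data.List.Relation.Unary.All as All
import Data.List.Relation.Unary.All.Properties as All
open import Data.List.Relation.Unary.Any using (here; there)
open import Data.List.Relation.Unary.Unique.Propositional using (Unique; []; _∷_)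
import Data.List.Relation.Unary.Unique.Propositional.Properties as Unique
open import Data.List.Membership.Propositional using (_∈_; _∉_)
open import Data.List.Membership.Propositional.Properties using (∈-filter⁻; ∈-++⁻)
open import Data.List.Membership.DecPropositional _≟_ using (_∈?_)
open import Data.Product using (∃; ∃₂; _×_; _,_; proj₁; proj₂; uncurry)
import Data.Product as Product
open import Data.Sum using (_⊎_; inj₁; inj₂)
import Data.Sum as Sum
open import Data.Maybe using (just; nothing)
open import Data.Maybe.Properties using (just-injective)
import Data.Maybe as M
open import Data.Unit using (tt)
open import Function using (_∘_; _$_; id; case_of_)
open import Function.Bundles using (Equivalence; _⇔_; mk⇔)
open import Relation.Nullary using (¬_; yes; no; contradiction)
open import Relation.Nullary.Decidable using (T?)
open import Relation.Binary.Definitions using (tri<; tri≈; tri>)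
open import Relation.Binary.PropositionalEquality
  using (_≡_; _≢_; ≢-sym; refl; sym; trans; cong; cong₂; subst; subst₂; module ≡-Reasoning)

≡ᵇ-refl : ∀ n → (n ≡ᵇ n) ≡ true
≡ᵇ-refl n = Equivalence.to T-≡ (≡⇒≡ᵇ n n refl)

≡ᵇ≡true⇒≡ : ∀ m n → (m ≡ᵇ n) ≡ true → m ≡ n
≡ᵇ≡true⇒≡ m n = ≡ᵇ⇒≡ m n ∘ Equivalence.from T-≡

≢⇒≡ᵇ≡false : ∀ m n → m ≢ n → (m ≡ᵇ n) ≡ false
≢⇒≡ᵇ≡false m n m≢n with m ≡ᵇ n in eq
... | false = refl
... | true  = contradiction (≡ᵇ≡true⇒≡ m n eq) m≢n

<⇒<ᵇ≡true : ∀ m n → m < n → (m <ᵇ n) ≡ true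
<⇒<ᵇ≡true m n = Equivalence.to T-≡ ∘ <⇒<ᵇ

<ᵇ≡true⇒< : ∀ m n → (m <ᵇ n) ≡ true → m < n
<ᵇ≡true⇒< m n = <ᵇ⇒< m n ∘ Equivalence.from T-≡

≥⇒<ᵇ≡false : ∀ m n → n ≤ m → (m <ᵇ n) ≡ false
≥⇒<ᵇ≡false m n n≤m with m <ᵇ n in eq
... | false = refl
... | true  = contradiction n≤m (<⇒≱ (<ᵇ≡true⇒< m n eq))

<ᵇ≡false⇒≥ : ∀ m n → (m <ᵇ n) ≡ false → n ≤ m
<ᵇ≡false⇒≥ m n eq = ≮⇒≥ (λ m<n → contradiction (trans (sym eq) (<⇒<ᵇ≡true m n m<n)) λ ())

bit : Bool → ℕ
bit true  = 1
bit false = 0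

count : {A : Set} → (A → Bool) → List A → ℕ
count p xs = length (filterᵇ p xs)

count-∷ : {A : Set} (p : A → Bool) (x : A) (xs : List A) → count p (x ∷ xs) ≡ bit (p x) + count p xs
count-∷ p x xs with p x
... | true  = refl
... | false = refl

count-++ : {A : Set} (p : A → Bool) (xs ys : List A) → count p (xs ++ ys) ≡ count p xs + count p ys
count-++ p xs ys = trans (cong length (filter-++ (T? ∘ p) xs ys)) (length-++ (filterᵇ p xs))

count-map : {A B : Set} (p : B → Bool) (f : A → B) (xs : List A) → count p (map f xs) ≡ count (p ∘ f) xs
count-map p f []       = refl
count-map p f (x ∷ xs) rewrite count-∷ p (f x) (map f xs) | count-∷ (p ∘ f) x xs = cong (bit (p (f x)) +_) (count-map p f xs)

module _ {A : Set} (p q r : A → Bool) where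

  count-+-≡ : ∀ xs → (∀ x → x ∈ xs → bit (p x) + bit (q x) ≡ bit (r x)) → count p xs + count q xs ≡ count r xs
  count-+-≡ []       _ = refl
  count-+-≡ (x ∷ xs) h
    rewrite count-∷ p x xs | count-∷ q x xs | count-∷ r x xs
    = trans (interchange (bit (p x)) (count p xs) (bit (q x)) (count q xs))
        (cong₂ _+_ (h x (here refl)) (count-+-≡ xs (λ y → h y ∘ there)))

  count-+-≤ : ∀ xs → (∀ x → x ∈ xs → bit (p x) + bit (q x) ≤ bit (r x)) → count p xs + count q xs ≤ count r xs
  count-+-≤ []       _ = z≤n
  count-+-≤ (x ∷ xs) h
    rewrite count-∷ p x xs | count-∷ q x xs | count-∷ r x xs
    = ≤-trans (≤-reflexive (interchange (bit (p x)) (count p xs) (bit (q x)) (count q xs)))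
        (+-mono-≤ (h x (here refl)) (count-+-≤ xs (λ y → h y ∘ there)))

count-mono : {A : Set} (p r : A → Bool) (xs : List A) → (∀ x → x ∈ xs → p x ≡ true → r x ≡ true) → count p xs ≤ count r xs
count-mono p r []       _ = z≤n
count-mono p r (x ∷ xs) h
  rewrite count-∷ p x xs | count-∷ r x xs
  = +-mono-≤ (bit-mono (p x) (r x) (h x (here refl))) (count-mono p r xs (λ y → h y ∘ there))
  where
  bit-mono : ∀ a b → (a ≡ true → b ≡ true) → bit a ≤ bit b
  bit-mono true  b f rewrite f refl = ≤-refl
  bit-mono false b f = z≤n

count-true+count-false : {A : Set} (p : A → Bool) (xs : List A) → count p xs + count (not ∘ p) xs ≡ length xs
count-true+count-false p xs =
  trans (count-+-≡ p (not ∘ p) (λ _ → true) xs (λ x _ → bit+bit-not (p x))) (count-const-true xs)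
  where
  bit+bit-not : ∀ b → bit b + bit (not b) ≡ 1
  bit+bit-not true  = refl
  bit+bit-not false = refl
  count-const-true : ∀ xs → count (λ _ → true) xs ≡ length xs
  count-const-true []       = refl
  count-const-true (_ ∷ xs) = cong suc (count-const-true xs)

length≤1+count-≢ : ∀ b {xs : List ℕ} → Unique xs → length xs ≤ suc (count (λ x → not (x ≡ᵇ b)) xs)
length≤1+count-≢ b {[]}     _ = z≤n
length≤1+count-≢ b {x ∷ xs} (x∉xs ∷ u) with x ≡ᵇ b in eq
... | true  = s≤s (≤-reflexive (sym (cong length (filter-all _ (All.map ≢b x∉xs)))))
  where
  ≢b : ∀ {y} → x ≢ y → T (not (y ≡ᵇ b))
  ≢b {y} x≢y with y ≡ᵇ b in eq′
  ... | false = _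
  ... | true  = x≢y (trans (≡ᵇ≡true⇒≡ x b eq) (sym (≡ᵇ≡true⇒≡ _ b eq′)))
... | false = s≤s (length≤1+count-≢ b u)

length-unique-≤ : ∀ a b {xs : List ℕ} → Unique xs → All (λ x → a ≤ x × x < b) xs → length xs ≤ b ∸ a
length-unique-≤ a b       {[]}     _ _                 = z≤n
length-unique-≤ a zero    {x ∷ xs} _ ((_ , ()) ∷ _)
length-unique-≤ a (suc b) {xs@(x ∷ _)} u bounds@((a≤x , x≤b) ∷ _) = begin
  length xs                     ≤⟨ length≤1+count-≢ b u ⟩
  suc (count ≢b xs)             ≤⟨ s≤s (length-unique-≤ a b (Unique.filter⁺ (T? ∘ ≢b) u) (All.tabulate below-b)) ⟩
  suc (b ∸ a)                   ≡⟨ sym (+-∸-assoc 1 (≤-trans a≤x (≤-pred x≤b))) ⟩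
  suc b ∸ a                     ∎
  where
  open ≤-Reasoning
  ≢b : ℕ → Bool
  ≢b y = not (y ≡ᵇ b)
  below-b : ∀ {y} → y ∈ filterᵇ ≢b xs → a ≤ y × y < b
  below-b y∈ with ∈-filter⁻ (T? ∘ ≢b) y∈
  ... | y∈xs , y≢b with All.lookup bounds y∈xs
  ... | a≤y , y≤b = a≤y , ≤∧≢⇒< (≤-pred y≤b) λ { refl → subst (T ∘ not) (≡ᵇ-refl b) y≢b }

-- The entries below j and those from j on are bounded in number by the lengths of the
-- intervals [1, j) and [j, m], and together there are m of them: both bounds are tight.
module UniqueRange (m : ℕ) {es : List ℕ} (unique : Unique es)
                   (range : All (λ x → 1 ≤ x × x ≤ m) es) (len : length es ≡ m) where

  private
    count-≤ : ∀ p a b → (∀ {x} → x ∈ es → p x ≡ true → a ≤ x × x < b) → count p es ≤ b ∸ a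
    count-≤ p a b h = length-unique-≤ a b (Unique.filter⁺ (T? ∘ p) unique) (All.tabulate bounds)
      where
      bounds : ∀ {x} → x ∈ filterᵇ p es → a ≤ x × x < b
      bounds x∈ = let (x∈es , px) = ∈-filter⁻ (T? ∘ p) x∈ in h x∈es (Equivalence.to T-≡ px)

    below : ∀ j → count (_<ᵇ j) es ≤ j ∸ 1
    below j = count-≤ (_<ᵇ j) 1 j λ x∈ x<j → proj₁ (All.lookup range x∈) , <ᵇ≡true⇒< _ j x<j

    above : ∀ j a → (∀ {x} → x ∈ es → j ≤ x → a ≤ x) → count (not ∘ (_<ᵇ j)) es ≤ suc m ∸ a
    above j a h = count-≤ (not ∘ (_<ᵇ j)) a (suc m) λ {x} x∈ x≮j →
      h x∈ (<ᵇ≡false⇒≥ x j (not-injective x≮j)) , s≤s (proj₂ (All.lookup range x∈))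
      where
      not-injective : ∀ {b} → not b ≡ true → b ≡ false
      not-injective {false} _ = refl

    split : ∀ j → count (_<ᵇ j) es + count (not ∘ (_<ᵇ j)) es ≡ m
    split j = trans (count-true+count-false (_<ᵇ j) es) len

  count-<ᵇ : ∀ j → 1 ≤ j → j ≤ m → count (_<ᵇ j) es ≡ j ∸ 1
  count-<ᵇ (suc j) _ j<m = ≤-antisym (below (suc j)) (begin
    j                     ≡⟨ sym (m∸[m∸n]≡n (≤-trans (n≤1+n j) j<m)) ⟩
    m ∸ (m ∸ j)           ≤⟨ ∸-monoʳ-≤ m (above (suc j) (suc j) (λ _ j<x → j<x)) ⟩
    m ∸ count≥            ≡⟨ cong (_∸ count≥) (sym (split (suc j))) ⟩
    count (_<ᵇ suc j) es + count≥ ∸ count≥ ≡⟨ m+n∸n≡m _ count≥ ⟩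
    count (_<ᵇ suc j) es  ∎)
    where
    open ≤-Reasoning
    count≥ = count (not ∘ (_<ᵇ suc j)) es

  ∈-range : ∀ j → 1 ≤ j → j ≤ m → j ∈ es
  ∈-range j 1≤j j≤m with j ∈? es
  ... | yes j∈ = j∈
  ... | no  j∉ = contradiction (begin-strict
    m                     ≡⟨ sym (split j) ⟩
    count (_<ᵇ j) es + count (not ∘ (_<ᵇ j)) es
                          ≤⟨ +-mono-≤ (below j) (above j (suc j) (λ x∈ j≤x → ≤∧≢⇒< j≤x λ { refl → j∉ x∈ })) ⟩
    j ∸ 1 + (m ∸ j)       ≡⟨ ∸-1+∸ j≤m 1≤j ⟩
    m ∸ 1                 <⟨ ∸-1< j≤m 1≤j ⟩
    m                     ∎) (<-irrefl refl)
    where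
    open ≤-Reasoning
    ∸-1+∸ : ∀ {j m} → j ≤ m → 1 ≤ j → j ∸ 1 + (m ∸ j) ≡ m ∸ 1
    ∸-1+∸ {suc j} {suc m} (s≤s j≤m) _ = m+[n∸m]≡n j≤m
    ∸-1< : ∀ {j m} → j ≤ m → 1 ≤ j → m ∸ 1 < m
    ∸-1< {suc j} {suc m} _ _ = ≤-refl

unique-map : {A B : Set} (f : A → B) {xs : List A} →
  (∀ {x y} → x ∈ xs → y ∈ xs → f x ≡ f y → x ≡ y) → Unique xs → Unique (map f xs)
unique-map f {[]}     _   []         = []
unique-map f {x ∷ xs} inj (x∉xs ∷ u) =
  All.map⁺ (All.tabulate λ y∈ fx≡fy → All.lookup x∉xs y∈ (inj (here refl) (there y∈) fx≡fy))
  ∷ unique-map f (λ x∈ y∈ → inj (there x∈) (there y∈)) u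

lookupL-< : ∀ (row : List ℕ) c {v} → lookupL row c ≡ just v → c < length row
lookupL-< (_ ∷ row) zero    _ = s≤s z≤n
lookupL-< (_ ∷ row) (suc c) e = s≤s (lookupL-< row c e)

lookupL-defined : ∀ (row : List ℕ) c → c < length row → ∃ λ v → lookupL row c ≡ just v
lookupL-defined (x ∷ row) zero    _         = x , refl
lookupL-defined (x ∷ row) (suc c) (s≤s c<) = lookupL-defined row c c<

∈⇒lookupL : ∀ {x} (row : List ℕ) → x ∈ row → ∃ λ c → lookupL row c ≡ just x
∈⇒lookupL (_ ∷ row) (here refl) = 0 , refl
∈⇒lookupL (_ ∷ row) (there x∈)  = let (c , e) = ∈⇒lookupL row x∈ in suc c , e

entry-sameShape : ∀ T U r c {v} → shape T ≡ shape U → entry T r c ≡ just v → ∃ λ w → entry U r c ≡ just w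
entry-sameShape (row ∷ T) (row′ ∷ U) zero    c sh e =
  lookupL-defined row′ c (subst (c <_) (∷-injectiveˡ sh) (lookupL-< row c e))
entry-sameShape (row ∷ T) (row′ ∷ U) (suc r) c sh e = entry-sameShape T U r c (∷-injectiveʳ sh) e

row-ext : ∀ (a b : List ℕ) → length a ≡ length b → (∀ c v → lookupL a c ≡ just v → lookupL b c ≡ just v) → a ≡ b
row-ext []      []      _   _ = refl
row-ext (x ∷ a) (y ∷ b) len h =
  cong₂ _∷_ (just-injective (sym (h 0 x refl))) (row-ext a b (suc-injective len) (λ c → h (suc c)))

filling-ext : ∀ T U → shape T ≡ shape U → (∀ r c v → entry T r c ≡ just v → entry U r c ≡ just v) → T ≡ U
filling-ext []      []      _  _ = refl
filling-ext (a ∷ T) (b ∷ U) sh h =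
  cong₂ _∷_ (row-ext a b (∷-injectiveˡ sh) (h 0)) (filling-ext T U (∷-injectiveʳ sh) (λ r → h (suc r)))

∈-rowCells⁻ : ∀ r c₀ row {r′ c v} → (r′ , c , v) ∈ rowCells r c₀ row →
  r′ ≡ r × ∃ λ k → c ≡ c₀ + k × lookupL row k ≡ just v
∈-rowCells⁻ r c₀ (x ∷ row) (here refl) = refl , 0 , sym (+-identityʳ c₀) , refl
∈-rowCells⁻ r c₀ (x ∷ row) (there x∈) with ∈-rowCells⁻ r (suc c₀) row x∈
... | r′≡r , k , c≡ , e = r′≡r , suc k , trans c≡ (sym (+-suc c₀ k)) , e

∈-allCells⁻ : ∀ k T {r c v} → (r , c , v) ∈ allCells k T → ∃ λ r′ → r ≡ k + r′ × entry T r′ c ≡ just v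
∈-allCells⁻ k (row ∷ T) x∈ with ∈-++⁻ (rowCells k 0 row) x∈
... | inj₁ x∈row with ∈-rowCells⁻ k 0 row x∈row
...   | r≡k , c , refl , e = 0 , trans r≡k (sym (+-identityʳ k)) , e
∈-allCells⁻ k (row ∷ T) x∈ | inj₂ x∈rest with ∈-allCells⁻ (suc k) T x∈rest
...   | r′ , r≡ , e = suc r′ , trans r≡ (sym (+-suc k r′)) , e

∈-cells⁻ : ∀ T {r c v} → (r , c , v) ∈ cells T → entry T r c ≡ just v
∈-cells⁻ T x∈ with ∈-allCells⁻ 0 T x∈
... | _ , refl , e = e

rowCells-bounds : ∀ r c₀ row {x} → x ∈ rowCells r c₀ row → cellRow x ≡ r × c₀ ≤ cellCol x
rowCells-bounds r c₀ row {_ , _ , _} x∈ with ∈-rowCells⁻ r c₀ row x∈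
... | r′≡r , k , refl , _ = r′≡r , m≤m+n c₀ k

allCells-row : ∀ k T {x} → x ∈ allCells k T → k ≤ cellRow x
allCells-row k T {_ , _ , _} x∈ with ∈-allCells⁻ k T x∈
... | r′ , refl , _ = m≤m+n k r′

unique-rowCells : ∀ r c₀ row → Unique (rowCells r c₀ row)
unique-rowCells r c₀ []        = []
unique-rowCells r c₀ (x ∷ row) =
  All.tabulate (λ y∈ → λ { refl → 1+n≰n (proj₂ (rowCells-bounds r (suc c₀) row y∈)) })
  ∷ unique-rowCells r (suc c₀) row

unique-allCells : ∀ k T → Unique (allCells k T)
unique-allCells k []        = []
unique-allCells k (row ∷ T) = Unique.++⁺ (unique-rowCells k 0 row) (unique-allCells (suc k) T)
  λ (x∈row , x∈rest) → 1+n≰n (subst (suc k ≤_) (proj₁ (rowCells-bounds k 0 row x∈row)) (allCells-row (suc k) T x∈rest))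

length-rowCells : ∀ r c₀ row → length (rowCells r c₀ row) ≡ length row
length-rowCells r c₀ []        = refl
length-rowCells r c₀ (x ∷ row) = cong suc (length-rowCells r (suc c₀) row)

length-allCells : ∀ k T → length (allCells k T) ≡ sum (shape T)
length-allCells k []        = refl
length-allCells k (row ∷ T) = trans (length-++ (rowCells k 0 row))
  (cong₂ _+_ (length-rowCells k 0 row) (length-allCells (suc k) T))

numCells≡sum-shape : ∀ T → numCells T ≡ sum (shape T)
numCells≡sum-shape []        = refl
numCells≡sum-shape (row ∷ T) = trans (length-++ row) (cong (length row +_) (numCells≡sum-shape T))

mapF : (ℕ → ℕ) → Filling → Filling
mapF g = map (map g)

lookupL-map : ∀ g (row : List ℕ) c → lookupL (map g row) c ≡ M.map g (lookupL row c)
lookupL-map g []        c       = refl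
lookupL-map g (x ∷ row) zero    = refl
lookupL-map g (x ∷ row) (suc c) = lookupL-map g row c

entry-mapF : ∀ g T r c → entry (mapF g T) r c ≡ M.map g (entry T r c)
entry-mapF g []        r       c = refl
entry-mapF g (row ∷ T) zero    c = lookupL-map g row c
entry-mapF g (row ∷ T) (suc r) c = entry-mapF g T r c

shape-mapF : ∀ g T → shape (mapF g T) ≡ shape T
shape-mapF g []        = refl
shape-mapF g (row ∷ T) = cong₂ _∷_ (length-map g row) (shape-mapF g T)

setCell : Filling → ℕ → ℕ → ℕ → Filling
setCell []        r       c y = []
setCell (row ∷ T) zero    c y = setAt c y row ∷ T
setCell (row ∷ T) (suc r) c y = row ∷ setCell T r c y

length-setAt : ∀ c y (row : List ℕ) → length (setAt c y row) ≡ length row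
length-setAt c       y []        = refl
length-setAt zero    y (x ∷ row) = refl
length-setAt (suc c) y (x ∷ row) = cong suc (length-setAt c y row)

shape-setCell : ∀ T r c y → shape (setCell T r c y) ≡ shape T
shape-setCell []        r       c y = refl
shape-setCell (row ∷ T) zero    c y = cong (_∷ shape T) (length-setAt c y row)
shape-setCell (row ∷ T) (suc r) c y = cong (length row ∷_) (shape-setCell T r c y)

lookupL-setAt-≡ : ∀ (row : List ℕ) c y {v} → lookupL row c ≡ just v → lookupL (setAt c y row) c ≡ just y
lookupL-setAt-≡ (x ∷ row) zero    y _ = refl
lookupL-setAt-≡ (x ∷ row) (suc c) y e = lookupL-setAt-≡ row c y e

lookupL-setAt-≢ : ∀ (row : List ℕ) c c′ y → c′ ≢ c → lookupL (setAt c y row) c′ ≡ lookupL row c′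
lookupL-setAt-≢ []        c       c′       y _  = refl
lookupL-setAt-≢ (x ∷ row) zero    zero     y ne = contradiction refl ne
lookupL-setAt-≢ (x ∷ row) zero    (suc c′) y _  = refl
lookupL-setAt-≢ (x ∷ row) (suc c) zero     y _  = refl
lookupL-setAt-≢ (x ∷ row) (suc c) (suc c′) y ne = lookupL-setAt-≢ row c c′ y (ne ∘ cong suc)

entry-setCell-≡ : ∀ T r c y {v} → entry T r c ≡ just v → entry (setCell T r c y) r c ≡ just y
entry-setCell-≡ (row ∷ T) zero    c y e = lookupL-setAt-≡ row c y e
entry-setCell-≡ (row ∷ T) (suc r) c y e = entry-setCell-≡ T r c y e

entry-setCell-≢ : ∀ T r c y r′ c′ → (r′ , c′) ≢ (r , c) → entry (setCell T r c y) r′ c′ ≡ entry T r′ c′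
entry-setCell-≢ []        r       c y r′       c′ _  = refl
entry-setCell-≢ (row ∷ T) zero    c y zero     c′ ne = lookupL-setAt-≢ row c c′ y (ne ∘ cong (0 ,_))
entry-setCell-≢ (row ∷ T) zero    c y (suc r′) c′ _  = refl
entry-setCell-≢ (row ∷ T) (suc r) c y zero     c′ _  = refl
entry-setCell-≢ (row ∷ T) (suc r) c y (suc r′) c′ ne =
  entry-setCell-≢ T r c y r′ c′ (ne ∘ cong (Product.map suc id))

-- Reading words and the crystal operator

rw-∷ : ∀ row T → rw (row ∷ T) ≡ rw T ++ row
rw-∷ row T = begin
  concat (reverse (row ∷ T))        ≡⟨ cong concat (unfold-reverse row T) ⟩
  concat (reverse T ++ [ row ])     ≡⟨ sym (concat-++ (reverse T) [ row ]) ⟩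
  rw T ++ row ++ []                 ≡⟨ cong (rw T ++_) (++-identityʳ row) ⟩
  rw T ++ row                       ∎
  where open ≡-Reasoning

take-length-++ : ∀ (xs ys : List ℕ) → take (length xs) (xs ++ ys) ≡ xs
take-length-++ []       ys = refl
take-length-++ (x ∷ xs) ys = cong (x ∷_) (take-length-++ xs ys)

drop-length-++ : ∀ (xs ys : List ℕ) → drop (length xs) (xs ++ ys) ≡ ys
drop-length-++ []       ys = refl
drop-length-++ (x ∷ xs) ys = drop-length-++ xs ys

splitBy-concat : ∀ (R : Filling) → splitBy (shape R) (concat R) ≡ R
splitBy-concat []      = refl
splitBy-concat (r ∷ R) = cong₂ _∷_ (take-length-++ r (concat R))
  (trans (cong (splitBy (shape R)) (drop-length-++ r (concat R))) (splitBy-concat R))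

unread : Filling → List ℕ → Filling
unread T w = reverse (splitBy (reverse (shape T)) w)

unread-rw : ∀ T → unread T (rw T) ≡ T
unread-rw T = begin
  reverse (splitBy (reverse (shape T)) (rw T))  ≡⟨ cong (λ sh → reverse (splitBy sh (rw T))) (sym (reverse-map length T)) ⟩
  reverse (splitBy (shape (reverse T)) (rw T))  ≡⟨ cong reverse (splitBy-concat (reverse T)) ⟩
  reverse (reverse T)                           ≡⟨ reverse-involutive T ⟩
  T                                             ∎
  where open ≡-Reasoning

unread-setCell : ∀ T r c y → unread T (rw (setCell T r c y)) ≡ setCell T r c y
unread-setCell T r c y = trans
  (cong (λ sh → reverse (splitBy (reverse sh) (rw (setCell T r c y)))) (sym (shape-setCell T r c y)))
  (unread-rw (setCell T r c y))

position-∷ : ∀ {i p p₀ x} w → (∃ λ q → p ≡ suc p₀ + q × lookupL w q ≡ just i) →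
  ∃ λ q → p ≡ p₀ + q × lookupL (x ∷ w) q ≡ just i
position-∷ {p₀ = p₀} w (q , p≡ , e) = suc q , trans p≡ (sym (+-suc p₀ q)) , e

rightmostUnmatched-result : ∀ i w o p₀ l {p} → rightmostUnmatched i w o p₀ l ≡ just p →
  l ≡ just p ⊎ ∃ λ q → p ≡ p₀ + q × lookupL w q ≡ just i
rightmostUnmatched-result i []      o p₀ l e = inj₁ e
rightmostUnmatched-result i (x ∷ w) o p₀ l e with x ≡ᵇ i in x≡ᵇi | o ≡ᵇ 0 | x ≡ᵇ suc i
... | true  | true  | _ with rightmostUnmatched-result i w 0 (suc p₀) (just p₀) e
...   | inj₁ refl  = inj₂ (0 , sym (+-identityʳ p₀) , cong just (≡ᵇ≡true⇒≡ x i x≡ᵇi))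
...   | inj₂ later = inj₂ (position-∷ w later)
rightmostUnmatched-result i (x ∷ w) o p₀ l e | true  | false | _ =
  Sum.map₂ (position-∷ w) (rightmostUnmatched-result i w (o ∸ 1) (suc p₀) l e)
rightmostUnmatched-result i (x ∷ w) o p₀ l e | false | _ | true =
  Sum.map₂ (position-∷ w) (rightmostUnmatched-result i w (suc o) (suc p₀) l e)
rightmostUnmatched-result i (x ∷ w) o p₀ l e | false | _ | false =
  Sum.map₂ (position-∷ w) (rightmostUnmatched-result i w o (suc p₀) l e)

rightmostUnmatched-∉ : ∀ i w → i ∉ w → ∀ o p l → rightmostUnmatched i w o p l ≡ l
rightmostUnmatched-∉ i []      _   o p l = refl
rightmostUnmatched-∉ i (x ∷ w) i∉w o p l with x ≡ᵇ i in x≡ᵇi | x ≡ᵇ suc i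
... | true  | _     = contradiction (here (sym (≡ᵇ≡true⇒≡ x i x≡ᵇi))) i∉w
... | false | true  = rightmostUnmatched-∉ i w (i∉w ∘ there) (suc o) (suc p) l
... | false | false = rightmostUnmatched-∉ i w (i∉w ∘ there) o (suc p) l

-- Without a letter i+1 in the prefix, no "(" is pending when the scan leaves it.
rightmostUnmatched-++ : ∀ i pre w → suc i ∉ pre → ∀ p l → ∃ λ l′ →
  rightmostUnmatched i (pre ++ w) 0 p l ≡ rightmostUnmatched i w 0 (p + length pre) l′
rightmostUnmatched-++ i []        w _       p l = l , cong (λ p → rightmostUnmatched i w 0 p l) (sym (+-identityʳ p))
rightmostUnmatched-++ i (x ∷ pre) w 1+i∉ p l =
  let l′ , e = after-x in l′ , trans e (cong (λ q → rightmostUnmatched i w 0 q l′) (sym (+-suc p (length pre))))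
  where
  after-x : ∃ λ l′ → rightmostUnmatched i (x ∷ pre ++ w) 0 p l ≡ rightmostUnmatched i w 0 (suc p + length pre) l′
  after-x with x ≡ᵇ i | x ≡ᵇ suc i in x≡ᵇ1+i
  ... | true  | _     = rightmostUnmatched-++ i pre w (1+i∉ ∘ there) (suc p) (just p)
  ... | false | true  = contradiction (here (sym (≡ᵇ≡true⇒≡ x (suc i) x≡ᵇ1+i))) 1+i∉
  ... | false | false = rightmostUnmatched-++ i pre w (1+i∉ ∘ there) (suc p) l

rightmostUnmatched-middle : ∀ i pre post → suc i ∉ pre → i ∉ post →
  rightmostUnmatched i (pre ++ i ∷ post) 0 0 nothing ≡ just (length pre)
rightmostUnmatched-middle i pre post 1+i∉pre i∉post with rightmostUnmatched-++ i pre (i ∷ post) 1+i∉pre 0 nothing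
... | _ , e rewrite ≡ᵇ-refl i = trans e (rightmostUnmatched-∉ i post i∉post 0 (suc (length pre)) (just (length pre)))

setAt-middle : ∀ (pre : List ℕ) x post y → setAt (length pre) y (pre ++ x ∷ post) ≡ pre ++ y ∷ post
setAt-middle []        x post y = refl
setAt-middle (z ∷ pre) x post y = cong (z ∷_) (setAt-middle pre x post y)

record RowSplit (row : List ℕ) (c v : ℕ) : Set where
  field
    pre post   : List ℕ
    row≡       : row ≡ pre ++ v ∷ post
    setAt≡     : ∀ y → setAt c y row ≡ pre ++ y ∷ post
    pre-left   : ∀ {x} → x ∈ pre  → ∃ λ c′ → c′ < c × lookupL row c′ ≡ just x
    post-right : ∀ {x} → x ∈ post → ∃ λ c′ → c < c′ × lookupL row c′ ≡ just x

rowSplit : ∀ row c {v} → lookupL row c ≡ just v → RowSplit row c v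
rowSplit (x ∷ row) zero refl = record
  { pre = [] ; post = row ; row≡ = refl ; setAt≡ = λ _ → refl ; pre-left = λ ()
  ; post-right = λ x∈ → let (c′ , e) = ∈⇒lookupL row x∈ in suc c′ , s≤s z≤n , e }
rowSplit (x ∷ row) (suc c) e = record
  { pre = x ∷ pre ; post = post ; row≡ = cong (x ∷_) row≡ ; setAt≡ = cong (x ∷_) ∘ setAt≡
  ; pre-left   = λ { (here refl) → 0 , s≤s z≤n , refl
                   ; (there y∈) → let (c′ , c′<c , e′) = pre-left y∈ in suc c′ , s≤s c′<c , e′ }
  ; post-right = λ y∈ → let (c′ , c<c′ , e′) = post-right y∈ in suc c′ , s≤s c<c′ , e′ }
  where open RowSplit (rowSplit row c e)

ReadBefore : ℕ × ℕ → ℕ × ℕ → Set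
ReadBefore (r′ , c′) (r , c) = r < r′ ⊎ (r′ ≡ r × c′ < c)

ReadBefore-suc : ∀ {r c r′ c′} → ReadBefore (r′ , c′) (r , c) → ReadBefore (suc r′ , c′) (suc r , c)
ReadBefore-suc (inj₁ r<r′)         = inj₁ (s≤s r<r′)
ReadBefore-suc (inj₂ (refl , c′<c)) = inj₂ (refl , c′<c)

ReadBefore-irrefl : ∀ {rc} → ¬ ReadBefore rc rc
ReadBefore-irrefl (inj₁ r<r)       = <-irrefl refl r<r
ReadBefore-irrefl (inj₂ (_ , c<c)) = <-irrefl refl c<c

¬ReadBefore : ∀ {r c r′ c′} → r′ ≤ r → c < c′ → ¬ ReadBefore (r′ , c′) (r , c)
¬ReadBefore r′≤r c<c′ (inj₁ r<r′)         = <⇒≱ r<r′ r′≤r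
¬ReadBefore r′≤r c<c′ (inj₂ (_ , c′<c)) = <-asym c<c′ c′<c

OccursBefore OccursAfter : Filling → ℕ → ℕ × ℕ → Set
OccursBefore T x rc = ∃₂ λ r′ c′ → entry T r′ c′ ≡ just x × ReadBefore (r′ , c′) rc
OccursAfter  T x rc = ∃₂ λ r′ c′ → entry T r′ c′ ≡ just x × ReadBefore rc (r′ , c′)

record WordSplit (T : Filling) (r c v : ℕ) : Set where
  field
    pre post    : List ℕ
    rw≡         : rw T ≡ pre ++ v ∷ post
    rw-setCell  : ∀ y → rw (setCell T r c y) ≡ pre ++ y ∷ post
    pre-before  : ∀ {x} → x ∈ pre  → OccursBefore T x (r , c)
    post-after  : ∀ {x} → x ∈ post → OccursAfter T x (r , c)

∈-rw⁻ : ∀ T {x} → x ∈ rw T → ∃₂ λ r c → entry T r c ≡ just x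
∈-rw⁻ (row ∷ T) {x} x∈ with ∈-++⁻ (rw T) (subst (x ∈_) (rw-∷ row T) x∈)
... | inj₁ x∈T   = let (r , c , e) = ∈-rw⁻ T x∈T in suc r , c , e
... | inj₂ x∈row = let (c , e) = ∈⇒lookupL row x∈row in 0 , c , e

wordSplit : ∀ T r c {v} → entry T r c ≡ just v → WordSplit T r c v
wordSplit (row ∷ T) zero c {v} e = record
  { pre = rw T ++ pre ; post = post
  ; rw≡ = trans (rw-∷ row T) (trans (cong (rw T ++_) row≡) (sym (++-assoc (rw T) pre (v ∷ post))))
  ; rw-setCell = λ y → trans (rw-∷ (setAt c y row) T) (trans (cong (rw T ++_) (setAt≡ y)) (sym (++-assoc (rw T) pre (y ∷ post))))
  ; pre-before = λ x∈ → case ∈-++⁻ (rw T) x∈ of λ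
      { (inj₁ x∈T)   → let (r′ , c′ , e′) = ∈-rw⁻ T x∈T in suc r′ , c′ , e′ , inj₁ (s≤s z≤n)
      ; (inj₂ x∈pre) → let (c′ , c′<c , e′) = pre-left x∈pre in 0 , c′ , e′ , inj₂ (refl , c′<c) }
  ; post-after = λ x∈ → let (c′ , c<c′ , e′) = post-right x∈ in 0 , c′ , e′ , inj₂ (refl , c<c′) }
  where open RowSplit (rowSplit row c e)
wordSplit (row ∷ T) (suc r) c {v} e = record
  { pre = pre ; post = post ++ row
  ; rw≡ = trans (rw-∷ row T) (trans (cong (_++ row) rw≡) (++-assoc pre (v ∷ post) row))
  ; rw-setCell = λ y → trans (rw-∷ row (setCell T r c y)) (trans (cong (_++ row) (rw-setCell y)) (++-assoc pre (y ∷ post) row))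
  ; pre-before = λ x∈ → let (r′ , c′ , e′ , before) = pre-before x∈ in suc r′ , c′ , e′ , ReadBefore-suc before
  ; post-after = λ x∈ → case ∈-++⁻ post x∈ of λ
      { (inj₁ x∈post) → let (r′ , c′ , e′ , after) = post-after x∈post in suc r′ , c′ , e′ , ReadBefore-suc after
      ; (inj₂ x∈row)  → let (c′ , e′) = ∈⇒lookupL row x∈row in 0 , c′ , e′ , inj₁ (s≤s z≤n) } }
  where open WordSplit (wordSplit T r c e)

lookupL-++ : ∀ (xs ys : List ℕ) p {v} → lookupL (xs ++ ys) p ≡ just v →
    (lookupL xs p ≡ just v × ∀ y → setAt p y (xs ++ ys) ≡ setAt p y xs ++ ys)
  ⊎ ∃ λ q → lookupL ys q ≡ just v × ∀ y → setAt p y (xs ++ ys) ≡ xs ++ setAt q y ys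
lookupL-++ []       ys p       e = inj₂ (p , e , λ _ → refl)
lookupL-++ (x ∷ xs) ys zero    e = inj₁ (e , λ _ → refl)
lookupL-++ (x ∷ xs) ys (suc p) e =
  Sum.map (Product.map₂ (λ setAt≡ → cong (x ∷_) ∘ setAt≡)) (Product.map₂ (Product.map₂ (λ setAt≡ → cong (x ∷_) ∘ setAt≡)))
          (lookupL-++ xs ys p e)

cellAt : ∀ T p {v} → lookupL (rw T) p ≡ just v →
  ∃₂ λ r c → entry T r c ≡ just v × ∀ y → setAt p y (rw T) ≡ rw (setCell T r c y)
cellAt (row ∷ T) p e with lookupL-++ (rw T) row p (subst (λ w → lookupL w p ≡ just _) (rw-∷ row T) e)
... | inj₁ (e′ , setAt≡) = let (r , c , eT , setAt≡T) = cellAt T p e′ in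
  suc r , c , eT , λ y → begin
    setAt p y (rw (row ∷ T))       ≡⟨ cong (setAt p y) (rw-∷ row T) ⟩
    setAt p y (rw T ++ row)        ≡⟨ setAt≡ y ⟩
    setAt p y (rw T) ++ row        ≡⟨ cong (_++ row) (setAt≡T y) ⟩
    rw (setCell T r c y) ++ row    ≡⟨ sym (rw-∷ row (setCell T r c y)) ⟩
    rw (setCell (row ∷ T) (suc r) c y) ∎
  where open ≡-Reasoning
... | inj₂ (q , e′ , setAt≡) = 0 , q , e′ , λ y → begin
    setAt p y (rw (row ∷ T))       ≡⟨ cong (setAt p y) (rw-∷ row T) ⟩
    setAt p y (rw T ++ row)        ≡⟨ setAt≡ y ⟩
    rw T ++ setAt q y row          ≡⟨ sym (rw-∷ (setAt q y row) T) ⟩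
    rw (setCell (row ∷ T) 0 q y)   ∎
  where open ≡-Reasoning

fTab≡ : ∀ i T → fTab i T ≡ M.map (λ p → unread T (setAt p (suc i) (rw T))) (rightmostUnmatched i (rw T) 0 0 nothing)
fTab≡ i T with rightmostUnmatched i (rw T) 0 0 nothing
... | nothing = refl
... | just p  = refl

fTab-changes-one-cell : ∀ i T {T′} → fTab i T ≡ just T′ →
  ∃₂ λ r c → entry T r c ≡ just i × T′ ≡ setCell T r c (suc i)
fTab-changes-one-cell i T e rewrite fTab≡ i T with rightmostUnmatched i (rw T) 0 0 nothing in found
fTab-changes-one-cell i T refl | just p with rightmostUnmatched-result i (rw T) 0 0 nothing found
... | inj₂ (q , refl , letter) =
  let (r , c , eT , setAt≡) = cellAt T q letter in
  r , c , eT , trans (cong (unread T) (setAt≡ (suc i))) (unread-setCell T r c (suc i))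

-- No "(" precedes the ")" of this cell, and no ")" follows it.
fTab-at : ∀ i T r c → entry T r c ≡ just i →
  ¬ OccursBefore T (suc i) (r , c) → ¬ OccursAfter T i (r , c) → fTab i T ≡ just (setCell T r c (suc i))
fTab-at i T r c e suc-entry-not-before entry-not-after = begin
  fTab i T                                                       ≡⟨ fTab≡ i T ⟩
  M.map raise (rightmostUnmatched i (rw T) 0 0 nothing)          ≡⟨ cong (λ w → M.map raise (rightmostUnmatched i w 0 0 nothing)) rw≡ ⟩
  M.map raise (rightmostUnmatched i (pre ++ i ∷ post) 0 0 nothing)
    ≡⟨ cong (M.map raise) (rightmostUnmatched-middle i pre post (suc-entry-not-before ∘ pre-before) (entry-not-after ∘ post-after)) ⟩
  just (unread T (setAt (length pre) (suc i) (rw T)))            ≡⟨ cong (λ w → just (unread T (setAt (length pre) (suc i) w))) rw≡ ⟩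
  just (unread T (setAt (length pre) (suc i) (pre ++ i ∷ post)))
    ≡⟨ cong (just ∘ unread T) (trans (setAt-middle pre i post (suc i)) (sym (rw-setCell (suc i)))) ⟩
  just (unread T (rw (setCell T r c (suc i))))                   ≡⟨ cong just (unread-setCell T r c (suc i)) ⟩
  just (setCell T r c (suc i))                                   ∎
  where
  open ≡-Reasoning
  open WordSplit (wordSplit T r c e)
  raise : ℕ → Filling
  raise p = unread T (setAt p (suc i) (rw T))

record IsTableau (T : Filling) : Set where
  field
    decreasing : Decreasing (shape T)
    rowWeak    : ∀ r c v w → entry T r c ≡ just v → entry T r (suc c) ≡ just w → v ≤ w
    colStrict  : ∀ r c v w → entry T r c ≡ just v → entry T (suc r) c ≡ just w → v < w

SSYT⇒IsTableau : ∀ {λ′ n T} → Decreasing λ′ → SSYT λ′ n T → IsTableau T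
SSYT⇒IsTableau dec (shape≡ , _ , rowWeak , colStrict) = record
  { decreasing = subst Decreasing (sym shape≡) dec ; rowWeak = rowWeak ; colStrict = colStrict }

entry-left : ∀ T r {c c′ w} → c ≤ c′ → entry T r c′ ≡ just w → ∃ λ v → entry T r c ≡ just v
entry-left (row ∷ T) zero    {c} {c′} c≤c′ e = lookupL-defined row c (≤-<-trans c≤c′ (lookupL-< row c′ e))
entry-left (row ∷ T) (suc r)          c≤c′ e = entry-left T r c≤c′ e

entry-up : ∀ T r c {w} → Decreasing (shape T) → entry T (suc r) c ≡ just w → ∃ λ v → entry T r c ≡ just v
entry-up (row ∷ row′ ∷ T) zero    c (len′≤len , _) e = lookupL-defined row c (<-≤-trans (lookupL-< row′ c e) len′≤len)
entry-up (row ∷ row′ ∷ T) (suc r) c (_ , dec)       e = entry-up (row′ ∷ T) r c dec e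

module _ {T : Filling} (tableau : IsTableau T) where
  open IsTableau tableau

  row-≤ : ∀ r {c} c′ {v w} → c ≤ c′ → entry T r c ≡ just v → entry T r c′ ≡ just w → v ≤ w
  row-≤ r zero     z≤n ev ew = ≤-reflexive (just-injective (trans (sym ev) ew))
  row-≤ r (suc c′) c≤  ev ew with m≤n⇒m<n∨m≡n c≤
  ... | inj₂ refl = ≤-reflexive (just-injective (trans (sym ev) ew))
  ... | inj₁ (s≤s c≤c′) with entry-left T r (n≤1+n c′) ew
  ...   | u , eu = ≤-trans (row-≤ r c′ c≤c′ ev eu) (rowWeak r c′ u _ eu ew)

  col-< : ∀ {r} r′ c {v w} → r < r′ → entry T r c ≡ just v → entry T r′ c ≡ just w → v < w
  col-< (suc r′) c r<  ev ew with m≤n⇒m<n∨m≡n r<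
  ... | inj₂ refl = colStrict _ c _ _ ev ew
  ... | inj₁ (s≤s r<r′) with entry-up T r′ c decreasing ew
  ...   | u , eu = <-trans (col-< r′ c r<r′ ev eu) (colStrict r′ c u _ eu ew)

  entry-≤ : ∀ {r c r′ c′ v w} → r ≤ r′ → c ≤ c′ → entry T r c ≡ just v → entry T r′ c′ ≡ just w → v ≤ w
  entry-≤ {r} {c} {r′} {c′} r≤r′ c≤c′ ev ew with entry-left T r′ c≤c′ ew | m≤n⇒m<n∨m≡n r≤r′
  ... | u , eu | inj₁ r<r′ = ≤-trans (<⇒≤ (col-< r′ c r<r′ ev eu)) (row-≤ r′ c′ c≤c′ eu ew)
  ... | u , eu | inj₂ refl = row-≤ r c′ c≤c′ ev ew

  entry-< : ∀ {r c r′ c′ v w} → r < r′ → c ≤ c′ → entry T r c ≡ just v → entry T r′ c′ ≡ just w → v < w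
  entry-< {r} {c} {r′} {c′} r<r′ c≤c′ ev ew with entry-left T r′ c≤c′ ew
  ... | u , eu = <-≤-trans (col-< r′ c r<r′ ev eu) (row-≤ r′ c′ c≤c′ eu ew)

-- Standardization

#below : List Cell → ℕ → ℕ
#below cs v = count (λ x → cellEntry x <ᵇ v) cs

#equalLeft : List Cell → ℕ → ℕ → ℕ
#equalLeft cs v c = count (λ x → (cellEntry x ≡ᵇ v) ∧ (cellCol x <ᵇ c)) cs

stdEntry : List Cell → ℕ → ℕ → ℕ
stdEntry cs c v = suc (#below cs v + #equalLeft cs v c)

lookupL-stdRow : ∀ cs c₀ row c → lookupL (stdRow cs c₀ row) c ≡ M.map (stdEntry cs (c₀ + c)) (lookupL row c)
lookupL-stdRow cs c₀ []        c       = refl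
lookupL-stdRow cs c₀ (x ∷ row) zero    rewrite +-identityʳ c₀ = refl
lookupL-stdRow cs c₀ (x ∷ row) (suc c) rewrite +-suc c₀ c = lookupL-stdRow cs (suc c₀) row c

entry-std : ∀ T r c → entry (std T) r c ≡ M.map (stdEntry (cells T) c) (entry T r c)
entry-std T = go T
  where
  go : ∀ U r c → entry (map (stdRow (cells T) 0) U) r c ≡ M.map (stdEntry (cells T) c) (entry U r c)
  go []        r       c = refl
  go (row ∷ U) zero    c = lookupL-stdRow (cells T) 0 row c
  go (row ∷ U) (suc r) c = go U r c

shape-std : ∀ T → shape (std T) ≡ shape T
shape-std T = go T
  where
  length-stdRow : ∀ c₀ row → length (stdRow (cells T) c₀ row) ≡ length row
  length-stdRow c₀ []        = refl
  length-stdRow c₀ (x ∷ row) = cong suc (length-stdRow (suc c₀) row)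
  go : ∀ U → shape (map (stdRow (cells T) 0) U) ≡ shape U
  go []        = refl
  go (row ∷ U) = cong₂ _∷_ (length-stdRow 0 row) (go U)

#below+#equalLeft≤#below : ∀ cs v c → #below cs v + #equalLeft cs v c ≤ #below cs (suc v)
#below+#equalLeft≤#below cs v c = count-+-≤ _ _ _ cs λ x _ → bits (cellEntry x) (cellCol x)
  where
  bits : ∀ e col → bit (e <ᵇ v) + bit ((e ≡ᵇ v) ∧ (col <ᵇ c)) ≤ bit (e <ᵇ suc v)
  bits e col with <-cmp e v
  ... | tri< e<v e≢v _ rewrite <⇒<ᵇ≡true e v e<v | ≢⇒≡ᵇ≡false e v e≢v | <⇒<ᵇ≡true e (suc v) (m<n⇒m<1+n e<v) = ≤-refl
  ... | tri≈ _ refl _  rewrite ≥⇒<ᵇ≡false e e ≤-refl | <⇒<ᵇ≡true e (suc e) ≤-refl | ≡ᵇ-refl e = bit≤1 (col <ᵇ c)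
    where
    bit≤1 : ∀ b → bit b ≤ 1
    bit≤1 true  = ≤-refl
    bit≤1 false = z≤n
  ... | tri> _ e≢v v<e rewrite ≥⇒<ᵇ≡false e v (<⇒≤ v<e) | ≢⇒≡ᵇ≡false e v e≢v | ≥⇒<ᵇ≡false e (suc v) v<e = ≤-refl

#below-mono : ∀ cs {v v′} → v ≤ v′ → #below cs v ≤ #below cs v′
#below-mono cs v≤v′ = count-mono _ _ cs λ x _ e → <⇒<ᵇ≡true _ _ (<-≤-trans (<ᵇ≡true⇒< _ _ e) v≤v′)

#equalLeft-mono : ∀ cs v {c c′} → c ≤ c′ → #equalLeft cs v c ≤ #equalLeft cs v c′
#equalLeft-mono cs v {c} {c′} c≤c′ = count-mono _ _ cs λ x _ → left (cellEntry x ≡ᵇ v)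
  where
  left : ∀ {col} b → (b ∧ (col <ᵇ c)) ≡ true → (b ∧ (col <ᵇ c′)) ≡ true
  left true e = <⇒<ᵇ≡true _ _ (<-≤-trans (<ᵇ≡true⇒< _ _ e) c≤c′)

stdEntry-<-value : ∀ cs {v w} c c′ → w < v → stdEntry cs c′ w ≤ stdEntry cs c v
stdEntry-<-value cs {v} {w} c c′ w<v = s≤s (begin
  #below cs w + #equalLeft cs w c′   ≤⟨ #below+#equalLeft≤#below cs w c′ ⟩
  #below cs (suc w)                  ≤⟨ #below-mono cs w<v ⟩
  #below cs v                        ≤⟨ m≤m+n _ _ ⟩
  #below cs v + #equalLeft cs v c    ∎)
  where open ≤-Reasoning

stdEntry-<⇒col< : ∀ cs v {c c′} → stdEntry cs c v < stdEntry cs c′ v → c < c′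
stdEntry-<⇒col< cs v {c} {c′} lt = ≰⇒> λ c′≤c →
  <⇒≱ (+-cancelˡ-< (#below cs v) _ _ (≤-pred lt)) (#equalLeft-mono cs v c′≤c)

relabel : (ℕ → ℕ) → Cell → Cell
relabel g (r , c , v) = r , c , g v

cells-mapF : ∀ g T → cells (mapF g T) ≡ map (relabel g) (cells T)
cells-mapF g = go 0
  where
  rowCells-map : ∀ r c₀ row → rowCells r c₀ (map g row) ≡ map (relabel g) (rowCells r c₀ row)
  rowCells-map r c₀ []        = refl
  rowCells-map r c₀ (x ∷ row) = cong ((r , c₀ , g x) ∷_) (rowCells-map r (suc c₀) row)
  go : ∀ k T → allCells k (mapF g T) ≡ map (relabel g) (allCells k T)
  go k []        = refl
  go k (row ∷ T) = trans (cong₂ _++_ (rowCells-map k 0 row) (go (suc k) T))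
    (sym (map-++ (relabel g) (rowCells k 0 row) (allCells (suc k) T)))

colOfIn : List Cell → ℕ → ℕ
colOfIn []       k = 0
colOfIn (x ∷ cs) k = if cellEntry x ≡ᵇ k then cellCol x else colOfIn cs k

∈-rowOfIn-colOfIn : ∀ cs {k} → k ∈ map cellEntry cs → (rowOfIn cs k , colOfIn cs k , k) ∈ cs
∈-rowOfIn-colOfIn ((r , c , e) ∷ cs) {k} k∈ with e ≡ᵇ k in e≡ᵇk | k∈
... | true  | _         rewrite ≡ᵇ≡true⇒≡ e k e≡ᵇk = here refl
... | false | here refl = contradiction (trans (sym (≡ᵇ-refl e)) e≡ᵇk) λ ()
... | false | there k∈cs = there (∈-rowOfIn-colOfIn cs k∈cs)

monotone-on : ∀ m (f : ℕ → ℕ) → (∀ j → 1 ≤ j → suc j ≤ m → f j ≤ f (suc j)) →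
  ∀ {j} k → 1 ≤ j → j ≤ k → k ≤ m → f j ≤ f k
monotone-on m f step zero    () z≤n _
monotone-on m f step (suc k) 1≤j j≤1+k 1+k≤m with m≤n⇒m<n∨m≡n j≤1+k
... | inj₂ refl       = ≤-refl
... | inj₁ (s≤s j≤k) = ≤-trans (monotone-on m f step k 1≤j j≤k (<⇒≤ 1+k≤m)) (step k (≤-trans 1≤j j≤k) 1+k≤m)

length-diffs : ∀ m p ds → length (diffs m p ds) ≡ suc (length ds)
length-diffs m p []       = refl
length-diffs m p (d ∷ ds) = cong suc (length-diffs m d ds)

module StandardTableau {λ′ : List ℕ} {m : ℕ} {S : Filling}
                       (decreasing : Decreasing λ′) (size : sum λ′ ≡ m) (standard : Standard λ′ m S) where

  shape-S : shape S ≡ λ′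
  shape-S = proj₁ (proj₁ standard)

  tableau-S : IsTableau S
  tableau-S = SSYT⇒IsTableau decreasing (proj₁ standard)

  numCells-S : numCells S ≡ m
  numCells-S = trans (numCells≡sum-shape S) (trans (cong sum shape-S) size)

  private
    entries : List ℕ
    entries = map cellEntry (cells S)

    unique-entries : Unique entries
    unique-entries = unique-map cellEntry
      (λ { {r , c , v} {r′ , c′ , .v} x∈ y∈ refl →
           let (r≡r′ , c≡c′) = proj₂ standard r c r′ c′ v (∈-cells⁻ S x∈) (∈-cells⁻ S y∈)
           in cong₂ (λ r c → r , c , v) r≡r′ c≡c′ })
      (unique-allCells 0 S)

    range-entries : All (λ x → 1 ≤ x × x ≤ m) entries
    range-entries = All.map⁺ (All.tabulate λ { {r , c , v} x∈ → proj₁ (proj₂ (proj₁ standard)) r c v (∈-cells⁻ S x∈) })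

    length-entries : length entries ≡ m
    length-entries = trans (length-map cellEntry (cells S))
      (trans (length-allCells 0 S) (trans (cong sum shape-S) size))

  open UniqueRange m unique-entries range-entries length-entries public

  R C : ℕ → ℕ
  R = rowOf S
  C = colOfIn (cells S)

  entry-S-label : ∀ j → 1 ≤ j → j ≤ m → entry S (R j) (C j) ≡ just j
  entry-S-label j 1≤j j≤m = ∈-cells⁻ S (∈-rowOfIn-colOfIn (cells S) (∈-range j 1≤j j≤m))

  label-of-cell : ∀ {r c v} → entry S r c ≡ just v → 1 ≤ v × v ≤ m × r ≡ R v × c ≡ C v
  label-of-cell {r} {c} {v} e =
    let (1≤v , v≤m) = proj₁ (proj₂ (proj₁ standard)) r c v e
        (r≡ , c≡)  = proj₂ standard r c (R v) (C v) v e (entry-S-label v 1≤v v≤m)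
    in 1≤v , v≤m , r≡ , c≡

  label-injective : ∀ {j k} → 1 ≤ j → j ≤ m → 1 ≤ k → k ≤ m → R j ≡ R k → C j ≡ C k → j ≡ k
  label-injective 1≤j j≤m 1≤k k≤m R≡ C≡ = just-injective
    (trans (sym (entry-S-label _ 1≤j j≤m)) (trans (cong₂ (entry S) R≡ C≡) (entry-S-label _ 1≤k k≤m)))

  isDescent : ℕ → Bool
  isDescent i = R i <ᵇ R (suc i)

  nDesc : ℕ → ℕ
  nDesc zero    = 0
  nDesc (suc k) = nDesc k + bit (isDescent (suc k))

  nDesc-mono : ∀ {j k} → j ≤ k → nDesc j ≤ nDesc k
  nDesc-mono {k = zero}  z≤n = ≤-refl
  nDesc-mono {k = suc k} j≤ with m≤n⇒m<n∨m≡n j≤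
  ... | inj₁ (s≤s j≤k) = ≤-trans (nDesc-mono j≤k) (m≤m+n (nDesc k) _)
  ... | inj₂ refl      = ≤-refl

  count-descents : ∀ k → count isDescent (map suc (upTo k)) ≡ nDesc k
  count-descents zero    = refl
  count-descents (suc k) = begin
    count isDescent (map suc (upTo (suc k)))                 ≡⟨ cong (count isDescent ∘ map suc) (sym (upTo-∷ʳ k)) ⟩
    count isDescent (map suc (upTo k ++ [ k ]))              ≡⟨ cong (count isDescent) (map-++ suc (upTo k) [ k ]) ⟩
    count isDescent (map suc (upTo k) ++ [ suc k ])          ≡⟨ count-++ isDescent (map suc (upTo k)) [ suc k ] ⟩
    count isDescent (map suc (upTo k)) + count isDescent [ suc k ]
                                                             ≡⟨ cong₂ _+_ (count-descents k) (trans (count-∷ isDescent (suc k) []) (+-identityʳ _)) ⟩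
    nDesc (suc k)                                            ∎
    where open ≡-Reasoning

  length-DesComp : length (DesComp S) ≡ suc (nDesc (m ∸ 1))
  length-DesComp = trans (length-diffs (numCells S) 0 (descents S))
    (cong suc (trans (cong (λ k → count isDescent (map suc (upTo (k ∸ 1)))) numCells-S) (count-descents (m ∸ 1))))

  NoDescent : ℕ → ℕ → Set
  NoDescent j k = ∀ d → j ≤ d → d < k → isDescent d ≡ false

  descent-or-none : ∀ j k → NoDescent j k ⊎ ∃ λ d → j ≤ d × d < k × isDescent d ≡ true
  descent-or-none j zero = inj₁ λ _ _ ()
  descent-or-none j (suc k) with descent-or-none j k | isDescent k in desc | j ≤? k
  ... | inj₂ (d , j≤d , d<k , e) | _     | _       = inj₂ (d , j≤d , m<n⇒m<1+n d<k , e)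
  ... | inj₁ _                   | true  | yes j≤k = inj₂ (k , j≤k , ≤-refl , desc)
  ... | inj₁ none                | _     | no j≰k  =
    inj₁ λ d j≤d d<1+k → none d j≤d (≤∧≢⇒< (≤-pred d<1+k) λ { refl → j≰k j≤d })
  ... | inj₁ none                | false | yes _   = inj₁ λ d j≤d d<1+k → case m≤n⇒m<n∨m≡n (≤-pred d<1+k) of λ
    { (inj₁ d<k) → none d j≤d d<k ; (inj₂ refl) → desc }

  -- Otherwise i+1 would lie weakly south-east of i in S.
  ascent-step : ∀ i → 1 ≤ i → suc i ≤ m → isDescent i ≡ false → R (suc i) ≤ R i × C i < C (suc i)
  ascent-step i 1≤i i<m asc = R≤ , ≰⇒> λ C≥ → 1+n≰n (entry-≤ tableau-S R≤ C≥
    (entry-S-label (suc i) (s≤s z≤n) i<m) (entry-S-label i 1≤i (<⇒≤ i<m)))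
    where
    R≤ = <ᵇ≡false⇒≥ (R i) (R (suc i)) asc

  north-east : ∀ {j} k → 1 ≤ j → j ≤ k → k ≤ m → NoDescent j k → R k ≤ R j × (j < k → C j < C k)
  north-east zero    () z≤n _ _
  north-east (suc k) 1≤j j≤1+k 1+k≤m none with m≤n⇒m<n∨m≡n j≤1+k
  ... | inj₂ refl      = ≤-refl , λ j<j → contradiction j<j (<-irrefl refl)
  ... | inj₁ (s≤s j≤k) =
    let (Rk≤Rj , Cj<Ck) = north-east k 1≤j j≤k (<⇒≤ 1+k≤m) (λ d j≤d d<k → none d j≤d (m<n⇒m<1+n d<k))
        (R≤ , C<)       = ascent-step k (≤-trans 1≤j j≤k) 1+k≤m (none k j≤k ≤-refl)
    in ≤-trans R≤ Rk≤Rj , λ _ → case m≤n⇒m<n∨m≡n j≤k of λ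
         { (inj₁ j<k) → <-trans (Cj<Ck j<k) C< ; (inj₂ refl) → C< }

  -- 0 if T has no cell (R j , C j)
  entryAt : Filling → ℕ → ℕ
  entryAt T j = M.fromMaybe 0 (entry T (R j) (C j))

  entry-label : ∀ {T} j → shape T ≡ λ′ → 1 ≤ j → j ≤ m → entry T (R j) (C j) ≡ just (entryAt T j)
  entry-label {T} j shape≡ 1≤j j≤m with entry-sameShape S T (R j) (C j) (trans shape-S (sym shape≡)) (entry-S-label j 1≤j j≤m)
  ... | _ , e rewrite e = refl

  label-of-entry : ∀ {T r c v} → shape T ≡ λ′ → entry T r c ≡ just v →
    ∃ λ j → entry S r c ≡ just j × 1 ≤ j × j ≤ m × r ≡ R j × c ≡ C j × v ≡ entryAt T j
  label-of-entry {T} {r} {c} shape≡ e with entry-sameShape T S r c (trans shape≡ (sym shape-S)) e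
  ... | j , eS with label-of-cell eS
  ...   | 1≤j , j≤m , refl , refl = j , eS , 1≤j , j≤m , refl , refl , just-injective (trans (sym e) (entry-label j shape≡ 1≤j j≤m))

  filling-ext-labels : ∀ {T U} → shape T ≡ λ′ → shape U ≡ λ′ →
    (∀ j → 1 ≤ j → j ≤ m → entryAt T j ≡ entryAt U j) → T ≡ U
  filling-ext-labels {T} {U} shT shU same = filling-ext T U (trans shT (sym shU)) λ r c v e →
    let (j , _ , 1≤j , j≤m , r≡ , c≡ , v≡) = label-of-entry shT e in
    trans (cong₂ (entry U) r≡ c≡) (trans (entry-label j shU 1≤j j≤m) (cong just (trans (sym (same j 1≤j j≤m)) (sym v≡))))

  -- Membership in V^n_S, expressed through the entries at the labels 1, …, m.
  record Compatible (n : ℕ) (T : Filling) : Set where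
    field
      shape≡     : shape T ≡ λ′
      bounded    : ∀ j → 1 ≤ j → j ≤ m → 1 ≤ entryAt T j × entryAt T j ≤ n
      increasing : ∀ j → 1 ≤ j → suc j ≤ m → entryAt T j + bit (isDescent j) ≤ entryAt T (suc j)

  module _ {n T} (compatible : Compatible n T) where
    open Compatible compatible

    entryAt-mono : ∀ {j} k → 1 ≤ j → j ≤ k → k ≤ m → entryAt T j ≤ entryAt T k
    entryAt-mono = monotone-on m (entryAt T) λ j 1≤j j<m → ≤-trans (m≤m+n _ _) (increasing j 1≤j j<m)

    entryAt-<-descent : ∀ {j d k} → 1 ≤ j → j ≤ d → d < k → k ≤ m → isDescent d ≡ true → entryAt T j < entryAt T k
    entryAt-<-descent {j} {d} {k} 1≤j j≤d d<k k≤m desc = begin-strict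
      entryAt T j                    ≤⟨ entryAt-mono d 1≤j j≤d (≤-trans (<⇒≤ d<k) k≤m) ⟩
      entryAt T d                    <⟨ ≤-reflexive (trans (+-comm 1 _) (cong (λ b → entryAt T d + bit b) (sym desc))) ⟩
      entryAt T d + bit (isDescent d) ≤⟨ increasing d (≤-trans 1≤j j≤d) (≤-trans d<k k≤m) ⟩
      entryAt T (suc d)              ≤⟨ entryAt-mono k (s≤s z≤n) d<k k≤m ⟩
      entryAt T k                    ∎
      where open ≤-Reasoning

    entryAt-≡⇒NoDescent : ∀ {j k} → 1 ≤ j → j ≤ k → k ≤ m → entryAt T j ≡ entryAt T k → NoDescent j k
    entryAt-≡⇒NoDescent 1≤j j≤k k≤m eq d j≤d d<k with isDescent d in desc
    ... | false = refl
    ... | true  = contradiction eq (<⇒≢ (entryAt-<-descent 1≤j j≤d d<k k≤m desc))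

    entryAt-≡⇒north-east : ∀ {j k} → 1 ≤ j → j < k → k ≤ m → entryAt T j ≡ entryAt T k → R k ≤ R j × C j < C k
    entryAt-≡⇒north-east 1≤j j<k k≤m eq =
      Product.map₂ (_$ j<k) (north-east _ 1≤j (<⇒≤ j<k) k≤m (entryAt-≡⇒NoDescent 1≤j (<⇒≤ j<k) k≤m eq))

    nDesc<entryAt : ∀ j → 1 ≤ j → j ≤ m → nDesc (j ∸ 1) < entryAt T j
    nDesc<entryAt (suc zero)    _ 1≤m   = proj₁ (bounded 1 (s≤s z≤n) 1≤m)
    nDesc<entryAt (suc (suc i)) _ 2+i≤m =
      ≤-trans (+-monoˡ-≤ (bit (isDescent (suc i))) (nDesc<entryAt (suc i) (s≤s z≤n) (<⇒≤ 2+i≤m)))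
              (increasing (suc i) (s≤s z≤n) 2+i≤m)

  stdEntry-label : ∀ {T} → shape T ≡ λ′ → std T ≡ S → ∀ j → 1 ≤ j → j ≤ m → stdEntry (cells T) (C j) (entryAt T j) ≡ j
  stdEntry-label {T} shape≡ std≡ j 1≤j j≤m = just-injective (begin
    just (stdEntry (cells T) (C j) (entryAt T j))
      ≡⟨ cong (M.map (stdEntry (cells T) (C j))) (sym (entry-label j shape≡ 1≤j j≤m)) ⟩
    M.map (stdEntry (cells T) (C j)) (entry T (R j) (C j))  ≡⟨ sym (entry-std T (R j) (C j)) ⟩
    entry (std T) (R j) (C j)                                ≡⟨ cong (λ U → entry U (R j) (C j)) std≡ ⟩
    entry S (R j) (C j)                                      ≡⟨ entry-S-label j 1≤j j≤m ⟩
    just j                                                   ∎)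
    where open ≡-Reasoning

  SSYT∩std⇒Compatible : ∀ {n T} → SSYT λ′ n T → std T ≡ S → Compatible n T
  SSYT∩std⇒Compatible {n} {T} ssyt@(shape≡ , bounded , _) std≡ = record
    { shape≡ = shape≡
    ; bounded = λ j 1≤j j≤m → bounded (R j) (C j) _ (entry-label j shape≡ 1≤j j≤m)
    ; increasing = increasing }
    where
    cs = cells T

    -- Standardization orders cells by entry, then by column. So T(j+1) < T(j) is impossible,
    -- and T(j) = T(j+1) puts j+1 right of j, which at a descent (a lower row) forces T(j) < T(j+1).
    increasing : ∀ j → 1 ≤ j → suc j ≤ m → entryAt T j + bit (isDescent j) ≤ entryAt T (suc j)
    increasing j 1≤j j<m with isDescent j in desc | <-cmp (entryAt T j) (entryAt T (suc j))
    ... | _     | tri> _ _ w<v = contradiction (begin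
          suc j                                             ≡⟨ sym (stdEntry-label shape≡ std≡ (suc j) (s≤s z≤n) j<m) ⟩
          stdEntry cs (C (suc j)) (entryAt T (suc j))       ≤⟨ stdEntry-<-value cs (C j) (C (suc j)) w<v ⟩
          stdEntry cs (C j) (entryAt T j)                   ≡⟨ stdEntry-label shape≡ std≡ j 1≤j (<⇒≤ j<m) ⟩
          j                                                 ∎) 1+n≰n
      where open ≤-Reasoning
    ... | false | tri< v<w _ _ = ≤-trans (≤-reflexive (+-identityʳ _)) (<⇒≤ v<w)
    ... | false | tri≈ _ v≡w _ = ≤-reflexive (trans (+-identityʳ _) v≡w)
    ... | true  | tri< v<w _ _ = ≤-trans (≤-reflexive (+-comm _ 1)) v<w
    ... | true  | tri≈ _ v≡w _ = contradiction v≡w (<⇒≢ (entry-< (SSYT⇒IsTableau decreasing ssyt)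
          (<ᵇ≡true⇒< (R j) (R (suc j)) desc) (<⇒≤ C<)
          (entry-label j shape≡ 1≤j (<⇒≤ j<m)) (entry-label (suc j) shape≡ (s≤s z≤n) j<m)))
      where
      C< : C j < C (suc j)
      C< = stdEntry-<⇒col< cs (entryAt T j) (subst₂ _<_
             (sym (stdEntry-label shape≡ std≡ j 1≤j (<⇒≤ j<m)))
             (sym (trans (cong (stdEntry cs (C (suc j))) v≡w) (stdEntry-label shape≡ std≡ (suc j) (s≤s z≤n) j<m)))
             ≤-refl)

  entryAt-mapF : ∀ g j → 1 ≤ j → j ≤ m → entryAt (mapF g S) j ≡ g j
  entryAt-mapF g j 1≤j j≤m = cong (M.fromMaybe 0)
    (trans (entry-mapF g S (R j) (C j)) (cong (M.map g) (entry-S-label j 1≤j j≤m)))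

  shape-mapF-S : ∀ g → shape (mapF g S) ≡ λ′
  shape-mapF-S g = trans (shape-mapF g S) shape-S

  module _ {n T} (compatible : Compatible n T) where
    open Compatible compatible

    ≡mapF-entryAt : T ≡ mapF (entryAt T) S
    ≡mapF-entryAt = filling-ext-labels shape≡ (shape-mapF-S (entryAt T)) λ j 1≤j j≤m → sym (entryAt-mapF (entryAt T) j 1≤j j≤m)

    std-indicator : ∀ j → 1 ≤ j → j ≤ m → ∀ k → 1 ≤ k → k ≤ m →
      bit (entryAt T k <ᵇ entryAt T j) + bit ((entryAt T k ≡ᵇ entryAt T j) ∧ (C k <ᵇ C j)) ≡ bit (k <ᵇ j)
    std-indicator j 1≤j j≤m k 1≤k k≤m with <-cmp k j
    ... | tri< k<j _ _ rewrite <⇒<ᵇ≡true k j k<j with m≤n⇒m<n∨m≡n (entryAt-mono compatible j 1≤k (<⇒≤ k<j) j≤m)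
    ...   | inj₁ Tk<Tj rewrite <⇒<ᵇ≡true _ _ Tk<Tj | ≢⇒≡ᵇ≡false _ _ (<⇒≢ Tk<Tj) = refl
    ...   | inj₂ Tk≡Tj rewrite Tk≡Tj | ≥⇒<ᵇ≡false (entryAt T j) (entryAt T j) ≤-refl | ≡ᵇ-refl (entryAt T j)
            | <⇒<ᵇ≡true _ _ (proj₂ (entryAt-≡⇒north-east compatible 1≤k k<j j≤m Tk≡Tj)) = refl
    std-indicator j 1≤j j≤m k 1≤k k≤m | tri≈ _ refl _
      rewrite ≥⇒<ᵇ≡false k k ≤-refl | ≥⇒<ᵇ≡false (entryAt T k) (entryAt T k) ≤-refl | ≡ᵇ-refl (entryAt T k)
            | ≥⇒<ᵇ≡false (C k) (C k) ≤-refl = refl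
    std-indicator j 1≤j j≤m k 1≤k k≤m | tri> _ _ j<k
      rewrite ≥⇒<ᵇ≡false k j (<⇒≤ j<k) with m≤n⇒m<n∨m≡n (entryAt-mono compatible k 1≤j (<⇒≤ j<k) k≤m)
    ...   | inj₁ Tj<Tk rewrite ≥⇒<ᵇ≡false _ _ (<⇒≤ Tj<Tk) | ≢⇒≡ᵇ≡false _ _ (≢-sym (<⇒≢ Tj<Tk)) = refl
    ...   | inj₂ Tj≡Tk rewrite sym Tj≡Tk | ≥⇒<ᵇ≡false (entryAt T j) (entryAt T j) ≤-refl | ≡ᵇ-refl (entryAt T j)
            | ≥⇒<ᵇ≡false _ _ (<⇒≤ (proj₂ (entryAt-≡⇒north-east compatible 1≤j j<k k≤m Tj≡Tk))) = refl

    stdEntry-entryAt : ∀ j → 1 ≤ j → j ≤ m → stdEntry (cells T) (C j) (entryAt T j) ≡ j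
    stdEntry-entryAt j 1≤j j≤m = begin
      suc (#below (cells T) v + #equalLeft (cells T) v (C j))
        ≡⟨ cong (λ U → suc (#below (cells U) v + #equalLeft (cells U) v (C j))) ≡mapF-entryAt ⟩
      suc (#below (cells (mapF (entryAt T) S)) v + #equalLeft (cells (mapF (entryAt T) S)) v (C j))
        ≡⟨ cong (λ cs → suc (#below cs v + #equalLeft cs v (C j))) (cells-mapF (entryAt T) S) ⟩
      suc (count below (map (relabel (entryAt T)) (cells S)) + count equalLeft (map (relabel (entryAt T)) (cells S)))
        ≡⟨ cong suc (cong₂ _+_ (count-map below _ (cells S)) (count-map equalLeft _ (cells S))) ⟩
      suc (count (below ∘ relabel (entryAt T)) (cells S) + count (equalLeft ∘ relabel (entryAt T)) (cells S))
        ≡⟨ cong suc (count-+-≡ _ _ ((_<ᵇ j) ∘ cellEntry) (cells S) λ { (r , c , k) x∈ →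
             let (1≤k , k≤m , r≡ , c≡) = label-of-cell (∈-cells⁻ S x∈) in
             subst (λ c → bit (entryAt T k <ᵇ v) + bit ((entryAt T k ≡ᵇ v) ∧ (c <ᵇ C j)) ≡ bit (k <ᵇ j)) (sym c≡)
                   (std-indicator j 1≤j j≤m k 1≤k k≤m) }) ⟩
      suc (count ((_<ᵇ j) ∘ cellEntry) (cells S))
        ≡⟨ cong suc (sym (count-map (_<ᵇ j) cellEntry (cells S))) ⟩
      suc (count (_<ᵇ j) (map cellEntry (cells S)))
        ≡⟨ cong suc (count-<ᵇ j 1≤j j≤m) ⟩
      suc (j ∸ 1)
        ≡⟨ trans (+-comm 1 (j ∸ 1)) (m∸n+n≡m 1≤j) ⟩
      j ∎
      where
      open ≡-Reasoning
      v = entryAt T j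
      below equalLeft : Cell → Bool
      below x = cellEntry x <ᵇ v
      equalLeft x = (cellEntry x ≡ᵇ v) ∧ (cellCol x <ᵇ C j)

    Compatible⇒SSYT∩std : SSYT λ′ n T × std T ≡ S
    Compatible⇒SSYT∩std = (shape≡ , bounded′ , rowWeak , colStrict) , std≡
      where
      module S = IsTableau tableau-S
      bounded′ : ∀ r c v → entry T r c ≡ just v → 1 ≤ v × v ≤ n
      bounded′ r c v e = let (j , _ , 1≤j , j≤m , _ , _ , v≡) = label-of-entry shape≡ e in
        subst (λ v → 1 ≤ v × v ≤ n) (sym v≡) (bounded j 1≤j j≤m)
      rowWeak : ∀ r c v w → entry T r c ≡ just v → entry T r (suc c) ≡ just w → v ≤ w
      rowWeak r c v w ev ew with label-of-entry shape≡ ev | label-of-entry shape≡ ew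
      ... | j , eSj , 1≤j , _ , _ , _ , refl | k , eSk , _ , k≤m , _ , _ , refl =
        entryAt-mono compatible k 1≤j (S.rowWeak r c j k eSj eSk) k≤m
      colStrict : ∀ r c v w → entry T r c ≡ just v → entry T (suc r) c ≡ just w → v < w
      colStrict r c v w ev ew with label-of-entry shape≡ ev | label-of-entry shape≡ ew
      ... | j , eSj , 1≤j , _ , r≡ , _ , refl | k , eSk , _ , k≤m , 1+r≡ , _ , refl with descent-or-none j k
      ...   | inj₂ (d , j≤d , d<k , desc) = entryAt-<-descent compatible 1≤j j≤d d<k k≤m desc
      ...   | inj₁ none = contradiction (subst₂ _≤_ (sym 1+r≡) (sym r≡) (proj₁ (north-east k 1≤j (<⇒≤ j<k) k≤m none))) 1+n≰n
        where j<k = S.colStrict r c j k eSj eSk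
      std≡ : std T ≡ S
      std≡ = filling-ext (std T) S (trans (shape-std T) (trans shape≡ (sym shape-S))) same-entries
        where
        same-entries : ∀ r c u → entry (std T) r c ≡ just u → entry S r c ≡ just u
        same-entries r c u e with entry T r c in eT | trans (sym e) (entry-std T r c)
        ... | just v | std-e with label-of-entry shape≡ eT
        ...   | j , eSj , 1≤j , j≤m , refl , refl , refl =
          trans eSj (cong just (trans (sym (stdEntry-entryAt j 1≤j j≤m)) (sym (just-injective std-e))))

  RaisedAt : Filling → Filling → ℕ → Set
  RaisedAt T T′ j = entryAt T′ j ≡ suc (entryAt T j) × (∀ k → 1 ≤ k → k ≤ m → k ≢ j → entryAt T′ k ≡ entryAt T k)

  Raised : Filling → Filling → Set
  Raised T T′ = ∃ λ j → 1 ≤ j × j ≤ m × RaisedAt T T′ j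

  Edge⇒Raised : ∀ {n T T′} → shape T ≡ λ′ → Edge n T T′ → Raised T T′
  Edge⇒Raised {T = T} shape≡ (i , _ , _ , fTab≡) with fTab-changes-one-cell i T fTab≡
  ... | r , c , e , refl with label-of-entry shape≡ e
  ...   | j , _ , 1≤j , j≤m , refl , refl , refl =
    j , 1≤j , j≤m , cong (M.fromMaybe 0) (entry-setCell-≡ T (R j) (C j) _ e) ,
    λ k 1≤k k≤m k≢j → cong (M.fromMaybe 0) (entry-setCell-≢ T (R j) (C j) _ (R k) (C k)
      λ pos≡ → k≢j (label-injective 1≤k k≤m 1≤j j≤m (cong proj₁ pos≡) (cong proj₂ pos≡)))

  -- With i = T(j): an entry i+1 of T sits at a label k > j with T′(k) = i+1 = T′(j), so no
  -- descent separates j and k, and (R k , C k) is north-east of (R j , C j), hence read later.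
  -- Symmetrically every other entry i sits south-west of (R j , C j) and is read earlier.
  module _ {n T T′} (compatible : Compatible n T) (compatible′ : Compatible n T′)
           {j} (1≤j : 1 ≤ j) (j≤m : j ≤ m) (raised : RaisedAt T T′ j) where
    open Compatible compatible
    private
      i = entryAt T j
      raised≡ = proj₁ raised
      others≡ = proj₂ raised
      unchanged : ∀ {k} → 1 ≤ k → k ≤ m → j < k → entryAt T′ k ≡ entryAt T k
      unchanged {k} 1≤k k≤m j<k = others≡ k 1≤k k≤m (≢-sym (<⇒≢ j<k))

    suc-entry-not-before : ¬ OccursBefore T (suc i) (R j , C j)
    suc-entry-not-before (r , c , e , before) with label-of-entry shape≡ e
    ... | k , _ , 1≤k , k≤m , refl , refl , Tk≡ with <-cmp j k
    ...   | tri< j<k _ _ = uncurry ¬ReadBefore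
      (entryAt-≡⇒north-east compatible′ 1≤j j<k k≤m (trans raised≡ (trans Tk≡ (sym (unchanged 1≤k k≤m j<k))))) before
    ...   | tri≈ _ refl _ = <⇒≢ (n<1+n i) (sym Tk≡)
    ...   | tri> _ _ k<j = 1+n≰n (subst (_≤ i) (sym Tk≡) (entryAt-mono compatible j 1≤k (<⇒≤ k<j) j≤m))

    entry-not-after : ¬ OccursAfter T i (R j , C j)
    entry-not-after (r , c , e , after) with label-of-entry shape≡ e
    ... | k , _ , 1≤k , k≤m , refl , refl , Tk≡ with <-cmp j k
    ...   | tri< j<k _ _ = 1+n≰n (begin
      suc i          ≡⟨ sym raised≡ ⟩
      entryAt T′ j   ≤⟨ entryAt-mono compatible′ k 1≤j (<⇒≤ j<k) k≤m ⟩
      entryAt T′ k   ≡⟨ trans (unchanged 1≤k k≤m j<k) (sym Tk≡) ⟩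
      i              ∎)
      where open ≤-Reasoning
    ...   | tri≈ _ refl _ = ReadBefore-irrefl after
    ...   | tri> _ _ k<j = uncurry ¬ReadBefore (entryAt-≡⇒north-east compatible 1≤k k<j j≤m (sym Tk≡)) after

    setCell≡ : setCell T (R j) (C j) (suc i) ≡ T′
    setCell≡ = filling-ext-labels (trans (shape-setCell T (R j) (C j) (suc i)) shape≡) (Compatible.shape≡ compatible′) same
      where
      same : ∀ k → 1 ≤ k → k ≤ m → entryAt (setCell T (R j) (C j) (suc i)) k ≡ entryAt T′ k
      same k 1≤k k≤m with k ≟ j
      ... | yes refl = trans (cong (M.fromMaybe 0) (entry-setCell-≡ T (R j) (C j) (suc i) (entry-label j shape≡ 1≤j j≤m))) (sym raised≡)
      ... | no  k≢j  = trans (cong (M.fromMaybe 0) (entry-setCell-≢ T (R j) (C j) (suc i) (R k) (C k)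
                         λ pos≡ → k≢j (label-injective 1≤k k≤m 1≤j j≤m (cong proj₁ pos≡) (cong proj₂ pos≡))))
                         (sym (others≡ k 1≤k k≤m k≢j))

  Raised⇒Edge : ∀ {n T T′} → Compatible n T → Compatible n T′ → Raised T T′ → Edge n T T′
  Raised⇒Edge {n} {T} compatible compatible′ (j , 1≤j , j≤m , raised) =
    entryAt T j , proj₁ (bounded j 1≤j j≤m) , subst (_≤ n) (proj₁ raised) (proj₂ (Compatible.bounded compatible′ j 1≤j j≤m)) ,
    trans (fTab-at (entryAt T j) T (R j) (C j) (entry-label j shape≡ 1≤j j≤m)
                   (suc-entry-not-before compatible compatible′ 1≤j j≤m raised) (entry-not-after compatible compatible′ 1≤j j≤m raised))
          (cong just (setCell≡ compatible compatible′ 1≤j j≤m raised))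
    where open Compatible compatible

oneRow : ℕ → Filling
oneRow m = [ applyUpTo suc m ]

lookupL-applyUpTo : ∀ (f : ℕ → ℕ) m c {v} → lookupL (applyUpTo f m) c ≡ just v → c < m × v ≡ f c
lookupL-applyUpTo f (suc m) zero    refl = s≤s z≤n , refl
lookupL-applyUpTo f (suc m) (suc c) e    = Product.map s≤s id (lookupL-applyUpTo (f ∘ suc) m c e)

oneRow-standard : ∀ m → Standard [ m ] m (oneRow m)
oneRow-standard m = (cong [_] (length-applyUpTo suc m) , bounded , rowWeak , (λ { zero _ _ _ _ () })) , unique
  where
  bounded : ∀ r c v → entry (oneRow m) r c ≡ just v → 1 ≤ v × v ≤ m
  bounded zero c v e with lookupL-applyUpTo suc m c e
  ... | c<m , refl = s≤s z≤n , c<m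
  rowWeak : ∀ r c v w → entry (oneRow m) r c ≡ just v → entry (oneRow m) r (suc c) ≡ just w → v ≤ w
  rowWeak zero c v w ev ew with lookupL-applyUpTo suc m c ev | lookupL-applyUpTo suc m (suc c) ew
  ... | _ , refl | _ , refl = n≤1+n _
  unique : ∀ r c r′ c′ v → entry (oneRow m) r c ≡ just v → entry (oneRow m) r′ c′ ≡ just v → r ≡ r′ × c ≡ c′
  unique zero c zero c′ v ev ev′ with lookupL-applyUpTo suc m c ev | lookupL-applyUpTo suc m c′ ev′
  ... | _ , refl | _ , c≡c′ = refl , suc-injective c≡c′

rowOf-oneRow : ∀ m k → rowOf (oneRow m) k ≡ 0
rowOf-oneRow m k = go (cells (oneRow m)) (λ x∈ → proj₁ (rowCells-bounds 0 0 (applyUpTo suc m) (subst (_ ∈_) (++-identityʳ _) x∈)))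
  where
  go : ∀ cs → (∀ {x} → x ∈ cs → cellRow x ≡ 0) → rowOfIn cs k ≡ 0
  go []       _    = refl
  go (x ∷ cs) row0 with cellEntry x ≡ᵇ k
  ... | true  = row0 (here refl)
  ... | false = go cs (row0 ∘ there)

module OneRow (m : ℕ) where
  open StandardTableau {S = oneRow m} tt (+-identityʳ m) (oneRow-standard m) public

  no-descent : ∀ j → isDescent j ≡ false
  no-descent j rewrite rowOf-oneRow m j | rowOf-oneRow m (suc j) = refl

  SSYT⇒Compatible : ∀ {N y} → SSYT [ m ] N y → Compatible N y
  SSYT⇒Compatible {N} {y} ssyt@(shape≡ , bounded , rowWeak , _) = record
    { shape≡ = shape≡
    ; bounded = λ j 1≤j j≤m → bounded (R j) (C j) _ (entry-label j shape≡ 1≤j j≤m)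
    ; increasing = λ j 1≤j j<m → subst (λ b → entryAt y j + bit b ≤ entryAt y (suc j)) (sym (no-descent j))
        (≤-trans (≤-reflexive (+-identityʳ _))
          (rowWeak 0 (C j) _ _ (at-row-0 j 1≤j (<⇒≤ j<m))
            (subst (λ c → entry y 0 c ≡ just (entryAt y (suc j))) (C-suc j 1≤j j<m) (at-row-0 (suc j) (s≤s z≤n) j<m)))) }
    where
    at-row-0 : ∀ j → 1 ≤ j → j ≤ m → entry y 0 (C j) ≡ just (entryAt y j)
    at-row-0 j 1≤j j≤m = subst (λ r → entry y r (C j) ≡ just (entryAt y j)) (rowOf-oneRow m j) (entry-label j shape≡ 1≤j j≤m)
    column : ∀ j → 1 ≤ j → j ≤ m → j ≡ suc (C j)
    column j 1≤j j≤m = proj₂ (lookupL-applyUpTo suc m (C j)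
      (subst (λ r → entry (oneRow m) r (C j) ≡ just j) (rowOf-oneRow m j) (entry-S-label j 1≤j j≤m)))
    C-suc : ∀ j → 1 ≤ j → suc j ≤ m → C (suc j) ≡ suc (C j)
    C-suc j 1≤j j<m = suc-injective (trans (sym (column (suc j) (s≤s z≤n) j<m)) (cong suc (column j 1≤j (<⇒≤ j<m))))

-- Flattening the label sequence

∸-step : ∀ {t t′} d e → t + e ≤ t′ → t ∸ d ≤ t′ ∸ (d + e)
∸-step {t} {t′} d e t+e≤t′ = begin
  t ∸ d              ≤⟨ ∸-monoˡ-≤ d (m+n≤o⇒m≤o∸n t t+e≤t′) ⟩
  t′ ∸ e ∸ d         ≡⟨ ∸-+-assoc t′ e d ⟩
  t′ ∸ (e + d)       ≡⟨ cong (t′ ∸_) (+-comm e d) ⟩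
  t′ ∸ (d + e)       ∎
  where open ≤-Reasoning

module Flatten {λ′ m S} (decreasing : Decreasing λ′) (size : sum λ′ ≡ m) (standard : Standard λ′ m S) (n : ℕ) where
  module Λ = StandardTableau decreasing size standard
  module Row = OneRow m
  open Λ using (nDesc; entryAt; isDescent; Compatible)

  N : ℕ
  N = n ∸ nDesc (m ∸ 1)

  -- subtracting the number of descents below j makes the label sequence weakly increasing
  flat : Filling → ℕ → ℕ
  flat T j = entryAt T j ∸ nDesc (j ∸ 1)

  flatten : Filling → Filling
  flatten T = mapF (flat T) (oneRow m)

  sharp : Filling → ℕ → ℕ
  sharp U j = Row.entryAt U j + nDesc (j ∸ 1)

  sharpen : Filling → Filling
  sharpen U = mapF (sharp U) S

  module _ {T} (compatible : Compatible n T) where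
    open Compatible compatible

    flat-step : ∀ j → 1 ≤ j → suc j ≤ m → flat T j ≤ flat T (suc j)
    flat-step (suc i) _ 2+i≤m = ∸-step (nDesc i) (bit (isDescent (suc i))) (increasing (suc i) (s≤s z≤n) 2+i≤m)

    flatten-compatible : Row.Compatible N (flatten T)
    flatten-compatible = record
      { shape≡ = Row.shape-mapF-S (flat T)
      ; bounded = λ j 1≤j j≤m → subst (λ v → 1 ≤ v × v ≤ N) (sym (Row.entryAt-mapF (flat T) j 1≤j j≤m))
          (m<n⇒0<n∸m (Λ.nDesc<entryAt compatible j 1≤j j≤m) , (begin
            flat T j                       ≤⟨ monotone-on m (flat T) flat-step m 1≤j j≤m ≤-refl ⟩
            entryAt T m ∸ nDesc (m ∸ 1)    ≤⟨ ∸-monoˡ-≤ (nDesc (m ∸ 1)) (proj₂ (bounded m (≤-trans 1≤j j≤m) ≤-refl)) ⟩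
            N                              ∎))
      ; increasing = λ j 1≤j j<m → subst₂ (λ v w → v + bit (Row.isDescent j) ≤ w)
          (sym (Row.entryAt-mapF (flat T) j 1≤j (<⇒≤ j<m))) (sym (Row.entryAt-mapF (flat T) (suc j) (s≤s z≤n) j<m))
          (subst (λ b → flat T j + bit b ≤ flat T (suc j)) (sym (Row.no-descent j))
            (≤-trans (≤-reflexive (+-identityʳ _)) (flat-step j 1≤j j<m))) }
      where open ≤-Reasoning

  module _ (nDesc≤n : nDesc (m ∸ 1) ≤ n) {U} (compatible : Row.Compatible N U) where
    open Row.Compatible compatible

    sharpen-compatible : Compatible n (sharpen U)
    sharpen-compatible = record
      { shape≡ = Λ.shape-mapF-S (sharp U)
      ; bounded = λ j 1≤j j≤m → subst (λ v → 1 ≤ v × v ≤ n) (sym (Λ.entryAt-mapF (sharp U) j 1≤j j≤m))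
          (≤-trans (proj₁ (bounded j 1≤j j≤m)) (m≤m+n _ _) , (begin
            Row.entryAt U j + nDesc (j ∸ 1)  ≤⟨ +-mono-≤ (proj₂ (bounded j 1≤j j≤m)) (Λ.nDesc-mono (∸-monoˡ-≤ 1 j≤m)) ⟩
            N + nDesc (m ∸ 1)                ≡⟨ m∸n+n≡m nDesc≤n ⟩
            n                                ∎))
      ; increasing = increasing′ }
      where
      open ≤-Reasoning
      increasing′ : ∀ j → 1 ≤ j → suc j ≤ m → entryAt (sharpen U) j + bit (isDescent j) ≤ entryAt (sharpen U) (suc j)
      increasing′ j@(suc i) 1≤j j<m
        rewrite Λ.entryAt-mapF (sharp U) j 1≤j (<⇒≤ j<m) | Λ.entryAt-mapF (sharp U) (suc j) (s≤s z≤n) j<m = begin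
        Row.entryAt U j + nDesc i + bit (isDescent j)  ≡⟨ +-assoc (Row.entryAt U j) (nDesc i) _ ⟩
        Row.entryAt U j + nDesc j                      ≤⟨ +-monoˡ-≤ (nDesc j) (Row.entryAt-mono compatible (suc j) 1≤j (n≤1+n j) j<m) ⟩
        Row.entryAt U (suc j) + nDesc j                ∎

    flatten-sharpen : flatten (sharpen U) ≡ U
    flatten-sharpen = Row.filling-ext-labels (Row.shape-mapF-S _) shape≡ λ j 1≤j j≤m → begin
      Row.entryAt (flatten (sharpen U)) j              ≡⟨ Row.entryAt-mapF (flat (sharpen U)) j 1≤j j≤m ⟩
      entryAt (sharpen U) j ∸ nDesc (j ∸ 1)            ≡⟨ cong (_∸ nDesc (j ∸ 1)) (Λ.entryAt-mapF (sharp U) j 1≤j j≤m) ⟩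
      Row.entryAt U j + nDesc (j ∸ 1) ∸ nDesc (j ∸ 1)  ≡⟨ m+n∸n≡m (Row.entryAt U j) (nDesc (j ∸ 1)) ⟩
      Row.entryAt U j                                  ∎
      where open ≡-Reasoning

  entryAt-flatten : ∀ T j → 1 ≤ j → j ≤ m → Row.entryAt (flatten T) j ≡ flat T j
  entryAt-flatten T = Row.entryAt-mapF (flat T)

  module _ {T T′} (compatible : Compatible n T) (compatible′ : Compatible n T′) where

    flat-cancel : ∀ {j} → 1 ≤ j → j ≤ m → flat T j ≡ flat T′ j → entryAt T j ≡ entryAt T′ j
    flat-cancel 1≤j j≤m =
      ∸-cancelʳ-≡ (<⇒≤ (Λ.nDesc<entryAt compatible _ 1≤j j≤m)) (<⇒≤ (Λ.nDesc<entryAt compatible′ _ 1≤j j≤m))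

    flatten-injective : flatten T ≡ flatten T′ → T ≡ T′
    flatten-injective eq = Λ.filling-ext-labels (Compatible.shape≡ compatible) (Compatible.shape≡ compatible′)
      λ j 1≤j j≤m → flat-cancel 1≤j j≤m
        (trans (sym (entryAt-flatten T j 1≤j j≤m)) (trans (cong (λ U → Row.entryAt U j) eq) (entryAt-flatten T′ j 1≤j j≤m)))

    flat-suc : ∀ {j} → 1 ≤ j → j ≤ m → flat T′ j ≡ suc (flat T j) ⇔ entryAt T′ j ≡ suc (entryAt T j)
    flat-suc {j} 1≤j j≤m = mk⇔
      (λ eq → ∸-cancelʳ-≡ (<⇒≤ (Λ.nDesc<entryAt compatible′ j 1≤j j≤m)) (≤-trans (<⇒≤ nDesc<) (n≤1+n _))
                          (trans eq (sym suc-∸)))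
      (λ eq → trans (cong (_∸ nDesc (j ∸ 1)) eq) suc-∸)
      where
      nDesc< = Λ.nDesc<entryAt compatible j 1≤j j≤m
      suc-∸ : suc (entryAt T j) ∸ nDesc (j ∸ 1) ≡ suc (flat T j)
      suc-∸ = +-∸-assoc 1 (<⇒≤ nDesc<)

    Raised⇔ : Λ.Raised T T′ ⇔ Row.Raised (flatten T) (flatten T′)
    Raised⇔ = mk⇔
      (λ (j , 1≤j , j≤m , raised , others) → j , 1≤j , j≤m ,
        via-flat {suc} j 1≤j j≤m (Equivalence.from (flat-suc 1≤j j≤m) raised) ,
        λ k 1≤k k≤m k≢j → via-flat {id} k 1≤k k≤m (cong (_∸ nDesc (k ∸ 1)) (others k 1≤k k≤m k≢j)))
      (λ (j , 1≤j , j≤m , raised , others) → j , 1≤j , j≤m ,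
        Equivalence.to (flat-suc 1≤j j≤m) (from-flat {suc} j 1≤j j≤m raised) ,
        λ k 1≤k k≤m k≢j → sym (flat-cancel 1≤k k≤m (sym (from-flat {id} k 1≤k k≤m (others k 1≤k k≤m k≢j)))))
      where
      via-flat : ∀ {f} j → 1 ≤ j → j ≤ m → flat T′ j ≡ f (flat T j) → Row.entryAt (flatten T′) j ≡ f (Row.entryAt (flatten T) j)
      via-flat {f} j 1≤j j≤m eq = trans (entryAt-flatten T′ j 1≤j j≤m) (trans eq (cong f (sym (entryAt-flatten T j 1≤j j≤m))))
      from-flat : ∀ {f} j → 1 ≤ j → j ≤ m → Row.entryAt (flatten T′) j ≡ f (Row.entryAt (flatten T) j) → flat T′ j ≡ f (flat T j)
      from-flat {f} j 1≤j j≤m eq = trans (sym (entryAt-flatten T′ j 1≤j j≤m)) (trans eq (cong f (entryAt-flatten T j 1≤j j≤m)))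

    Edge⇔ : Edge n T T′ ⇔ Edge N (flatten T) (flatten T′)
    Edge⇔ = mk⇔
      (Row.Raised⇒Edge (flatten-compatible compatible) (flatten-compatible compatible′)
        ∘ Equivalence.to Raised⇔ ∘ Λ.Edge⇒Raised (Compatible.shape≡ compatible))
      (Λ.Raised⇒Edge compatible compatible′
        ∘ Equivalence.from Raised⇔ ∘ Row.Edge⇒Raised (Row.Compatible.shape≡ (flatten-compatible compatible)))

  flatten-iso : nDesc (m ∸ 1) ≤ n → DiGraphIso (VS λ′ n S) (Edge n) (SSYT [ m ] N) (Edge N)
  flatten-iso nDesc≤n =
      flatten
    , (λ T V → proj₁ (Row.Compatible⇒SSYT∩std (flatten-compatible (compatible V))))
    , (λ T T′ V V′ → flatten-injective (compatible V) (compatible V′))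
    , (λ U ssyt → let compatibleU = Row.SSYT⇒Compatible ssyt in
         sharpen U , Λ.Compatible⇒SSYT∩std (sharpen-compatible nDesc≤n compatibleU) , flatten-sharpen nDesc≤n compatibleU)
    , λ T T′ V V′ → Edge⇔ (compatible V) (compatible V′)
    where
    compatible : ∀ {T} → VS λ′ n S T → Compatible n T
    compatible (ssyt , std≡) = Λ.SSYT∩std⇒Compatible ssyt std≡

mainTheorem3 : (m s n : ℕ) (α λ′ : List ℕ) (S : Filling)
    → IsComposition m s α
    → s ≤ n
    → IsPartition m λ′
    → Standard λ′ m S
    → DesComp S ≡ α
    → DiGraphIso (VS λ′ n S) (Edge n) (SSYT [ m ] (n ∸ s + 1)) (Edge (n ∸ s + 1))
mainTheorem3 m s n α λ′ S (_ , _ , length-α) s≤n (_ , decreasing , size) standard desComp≡ =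
  subst (λ N → DiGraphIso (VS λ′ n S) (Edge n) (SSYT [ m ] N) (Edge N)) (sym N≡) (flatten-iso (<⇒≤ nDesc<n))
  where
  open Flatten decreasing size standard n
  open ≡-Reasoning
  s≡ : s ≡ suc (Λ.nDesc (m ∸ 1))
  s≡ = trans (sym length-α) (trans (cong length (sym desComp≡)) Λ.length-DesComp)
  nDesc<n : Λ.nDesc (m ∸ 1) < n
  nDesc<n = subst (_≤ n) s≡ s≤n
  N≡ : n ∸ s + 1 ≡ N
  N≡ = begin
    n ∸ s + 1                        ≡⟨ cong (λ s → n ∸ s + 1) s≡ ⟩
    n ∸ suc (Λ.nDesc (m ∸ 1)) + 1    ≡⟨ +-comm _ 1 ⟩
    suc (n ∸ suc (Λ.nDesc (m ∸ 1)))  ≡⟨ sym (+-∸-assoc 1 nDesc<n) ⟩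
    N                                ∎
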